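{- For integers $n\ge 1$, $k\ge1$, let $a_{n,k}(213)$ be the number of cyclic permutations $\pi\in\mathfrak S_n$ whose one-line notation avoids $\delta_k=k(k-1)\cdots 21$ and whose cycle form $C(\pi)$ avoids $213$, and let $b_{n,k}(213)$ be the number of such permutations that additionally satisfy $\pi_1=n$. Then for $n\ge 2$ and $k\ge 3$, \[a_{n,k}(213)=\sum_{j=2}^{n} b_{j,k}(213)\,a_{n+1-j,k}(213).\]
   Context: A permutation $\pi\in\mathfrak S_n$ is cyclic if it is a single $n$-cycle. Its cycle form is $C(\pi)=(1,c_2,\dots,c_n)$ with $c_2=\pi(1)$, $c_{i+1}=\pi(c_i)$; $C(\pi)$ avoids a pattern if the sequence $1,c_2,\dots,c_n$ does. A sequence avoids $\sigma\in\mathfrak S_m$ if no length-$m$ subsequence is order-isomorphic to $\sigma$. One-line notation: $\pi_1\cdots\pi_n$ with $\pi_i=\pi(i)$. -}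

module Defs where

open import Data.Nat using (ℕ; zero; suc; _+_; _∸_; _<ᵇ_; _≡ᵇ_)
open import Data.Bool using (Bool; true; false; _∧_; _∨_; not; if_then_else_)
open import Data.List using (List; []; _∷_; _++_; map; concatMap; length)

-- A permutation of [n] = {1,…,n} is represented by its one-line notation
-- π₁ π₂ ⋯ πₙ, a list of natural numbers (values in 1..n).

insertions : ℕ → List ℕ → List (List ℕ)
insertions x [] = (x ∷ []) ∷ []
insertions x (y ∷ ys) = (x ∷ y ∷ ys) ∷ map (y ∷_) (insertions x ys)

perms : ℕ → List (List ℕ)
perms zero = [] ∷ []
perms (suc n) = concatMap (insertions (suc n)) (perms n)

-- π(i) for a one-line list (1-indexed); 0 if out of range
app : List ℕ → ℕ → ℕ
app [] i = 0
app (x ∷ xs) zero = 0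
app (x ∷ xs) (suc zero) = x
app (x ∷ xs) (suc (suc i)) = app xs (suc i)

iterates : List ℕ → ℕ → ℕ → List ℕ
iterates π zero c = []
iterates π (suc k) c = c ∷ iterates π k (app π c)

-- cycle form C(π) = (1, c₂, …, cₙ) written as the sequence 1, c₂, …, cₙ
cycleForm : List ℕ → List ℕ
cycleForm π = iterates π (length π) 1

elemᵇ : ℕ → List ℕ → Bool
elemᵇ x [] = false
elemᵇ x (y ∷ ys) = (x ≡ᵇ y) ∨ elemᵇ x ys

distinctᵇ : List ℕ → Bool
distinctᵇ [] = true
distinctᵇ (x ∷ xs) = not (elemᵇ x xs) ∧ distinctᵇ xs

-- π ∈ 𝔖ₙ is cyclic (a single n-cycle) iff the orbit 1, π(1), …, π^{n-1}(1)
-- consists of n distinct elements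
isCyclic : List ℕ → Bool
isCyclic π = distinctᵇ (cycleForm π)

subseqs : ℕ → List ℕ → List (List ℕ)
subseqs zero xs = [] ∷ []
subseqs (suc m) [] = []
subseqs (suc m) (x ∷ xs) = map (x ∷_) (subseqs m xs) ++ subseqs (suc m) xs

allᵇ : {A : Set} → (A → Bool) → List A → Bool
allᵇ p [] = true
allᵇ p (x ∷ xs) = p x ∧ allᵇ p xs

anyᵇ : {A : Set} → (A → Bool) → List A → Bool
anyᵇ p [] = false
anyᵇ p (x ∷ xs) = p x ∨ anyᵇ p xs

-- order-isomorphism of two equal-length sequences:
-- for all positions i, j: sᵢ < sⱼ ⇔ tᵢ < tⱼ  (all sequences here have distinct entries
-- and patterns are permutations, so this is the standard notion)
ltAgree : ℕ → ℕ → ℕ → ℕ → Bool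
ltAgree a b c d = if a <ᵇ b then c <ᵇ d else not (c <ᵇ d)

orderIso : List ℕ → List ℕ → Bool
orderIso [] [] = true
orderIso (a ∷ s) (c ∷ t) =
  allᵇ (λ p → p) (zipWithB a c s t) ∧ orderIso s t
  where
  zipWithB : ℕ → ℕ → List ℕ → List ℕ → List Bool
  zipWithB a c [] [] = []
  zipWithB a c (b ∷ bs) (d ∷ ds) = (ltAgree a b c d ∧ ltAgree b a d c) ∷ zipWithB a c bs ds
  zipWithB a c _ _ = false ∷ []
orderIso _ _ = false

contains : List ℕ → List ℕ → Bool
contains σ s = anyᵇ (λ t → orderIso t σ) (subseqs (length σ) s)

avoids : List ℕ → List ℕ → Bool
avoids σ s = not (contains σ s)

δ : ℕ → List ℕ
δ k = downFrom' k
  where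
  downFrom' : ℕ → List ℕ
  downFrom' zero = []
  downFrom' (suc m) = suc m ∷ downFrom' m

p213 : List ℕ
p213 = 2 ∷ 1 ∷ 3 ∷ []

goodA : ℕ → List ℕ → Bool
goodA k π = isCyclic π ∧ avoids (δ k) π ∧ avoids p213 (cycleForm π)

count : {A : Set} → (A → Bool) → List A → ℕ
count p [] = 0
count p (x ∷ xs) = (if p x then 1 else 0) + count p xs

a : ℕ → ℕ → ℕ
a n k = count (goodA k) (perms n)

firstIs : ℕ → List ℕ → Bool
firstIs n [] = false
firstIs n (x ∷ _) = x ≡ᵇ n

b : ℕ → ℕ → ℕ
b n k = count (λ π → goodA k π ∧ firstIs n π) (perms n)

sumFromTo : ℕ → ℕ → (ℕ → ℕ) → ℕ
sumFromTo lo hi f = go lo (suc hi ∸ lo)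
  where
  go : ℕ → ℕ → ℕ
  go i zero = 0
  go i (suc r) = f i + go (suc i) r

module Submission where

-- Write π ∈ 𝔖ₙ with π₁ = j in cycle form (1, j, r). If the cycle form avoids 213, every
-- entry of r above j comes before every entry below j, so r = L ++ S with L > j > S. Then
-- (1, j, S) is the cycle form of a cyclic β ∈ 𝔖ⱼ with β₁ = j and (1, L − (j − 1)) that of a
-- cyclic α ∈ 𝔖ₙ₊₁₋ⱼ, and every such pair arises exactly once. In one-line notation π is
-- β₁ ⋯ βⱼ₋₁ followed by α shifted up by j − 1, except that the entry 1 of α becomes βⱼ.
-- A decreasing subsequence of π either lies in the α-part or starts in the β-part, in which
-- case its only possible later entry is βⱼ; so π avoids δₖ iff β and α do, and likewise the
-- cycle form of π avoids 213 iff those of β and α do. Summing over j = π₁ gives the identity.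

open import Defs
open import Data.Bool using (Bool; true; false; T; _∧_; not; if_then_else_)
open import Data.Bool.Properties using (T-∧; T-∨; T-≡; ∧-zeroʳ; ∧-identityʳ; ∧-conicalʳ)
open import Data.Empty using (⊥-elim)
open import Data.List
  using (List; []; _∷_; _++_; [_]; map; length; take; drop; takeWhile; dropWhile; filter; filterᵇ;
         concatMap; applyUpTo; zip; cartesianProduct)
open import Data.List.Properties
  using (∷-injectiveˡ; ∷-injectiveʳ; length-++; length-map; length-take; length-applyUpTo;
         map-++; map-∘; map-id; map-cong; map-cong-local; map-id-local; map-applyUpTo; applyUpTo-∷ʳ;
         ++-assoc; ++-identityʳ; filter-++; filter-all; filter-none; takeWhile++dropWhile)
open import Data.List.Membership.Propositional using (_∈_; _∉_; find; lose)
open import Data.List.Membership.Propositional.Properties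
  using (∈-∃++; ∈-++⁻; ∈-++⁺ˡ; ∈-++⁺ʳ; ∈-map⁺; ∈-map⁻; ∈-filter⁺; ∈-filter⁻; ∈-applyUpTo⁺;
         ∈-applyUpTo⁻; ∈-concatMap⁺; ∈-concatMap⁻; ∈-cartesianProduct⁺; ∈-cartesianProduct⁻)
open import Data.List.Relation.Binary.Subset.Propositional using (_⊆_)
open import Data.List.Relation.Binary.Sublist.Propositional
  using ([]; _∷_; _∷ʳ_; minimum; lookup; from∈; ⊆-refl; ⊆-trans) renaming (_⊆_ to _⊑_)
open import Data.List.Relation.Binary.Sublist.Propositional.Properties
  using (All-resp-⊆; ++⁺; ++⁺ˡ; ++⁺ʳ) renaming (map⁺ to ⊑-map⁺)
open import Data.List.Relation.Binary.Permutation.Propositional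
  using (_↭_; ↭-refl; ↭-prep; ↭-sym; ↭-trans; ↭⇒↭ₛ; module PermutationReasoning)
open import Data.List.Relation.Binary.Permutation.Propositional.Properties
  using (↭-length; ↭-empty-inv; ∈-resp-↭; shift; ∷↭∷ʳ; drop-mid; drop-∷; ++-comm; filter-↭)
  renaming (map⁺ to ↭-map⁺; ++⁺ to ↭-++⁺)
import Data.List.Relation.Binary.Permutation.Setoid.Properties as ↭ₛ
open import Data.List.Relation.Unary.All as All using (All; []; _∷_)
import Data.List.Relation.Unary.All.Properties as All
open import Data.List.Relation.Unary.All.Properties.Core using (¬Any⇒All¬; All¬⇒¬Any)
open import Data.List.Relation.Unary.AllPairs as AllPairs using (AllPairs; []; _∷_)
import Data.List.Relation.Unary.AllPairs.Properties as AllPairs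
open import Data.List.Relation.Unary.Any using (here; there)
open import Data.List.Relation.Unary.Unique.Propositional using (Unique)
import Data.List.Relation.Unary.Unique.Propositional.Properties as Unique
open import Data.Nat
  using (ℕ; zero; suc; _+_; _*_; _∸_; _⊓_; _≤_; _<_; _>_; _≡ᵇ_; _<ᵇ_;
         z≤n; s≤s; s≤s⁻¹; z<s; s<s)
open import Data.Nat.Properties
open import Algebra.Properties.CommutativeSemigroup +-commutativeSemigroup using (interchange)
open import Data.Product using (∃-syntax; ∃₂; _×_; _,_; proj₁; proj₂; uncurry)
open import Data.Sum using (_⊎_; inj₁; inj₂; [_,_]′)
open import Data.Unit using (tt)
open import Function using (_∘_; id; _⇔_; mk⇔; Equivalence)
open import Level using (0ℓ)
open import Relation.Binary using (Rel; _Respects_; _Preserves_⟶_; tri<; tri≈; tri>)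
open import Relation.Binary.PropositionalEquality hiding ([_])
open import Relation.Nullary using (¬_; yes; no; ¬?)
open import Relation.Nullary.Decidable using (dec-true; dec-false)
open import Relation.Unary using (Pred; Decidable; ∁)

open Equivalence using (to; from)

private
  variable
    A B : Set
    f g : ℕ → ℕ
    h i j j1 k m n r x y z : ℕ
    xs ys us vs : List A
    as bs cs ds c l s t π : List ℕ

-- Duplicate-free lists

Unique-resp-↭ : Unique {A = A} Respects _↭_
Unique-resp-↭ p = ↭ₛ.Unique-resp-↭ (setoid _) (↭⇒↭ₛ p)

Unique-⊆⇒↭-++ : Unique xs → xs ⊆ ys → ∃[ zs ] xs ++ zs ↭ ys
Unique-⊆⇒↭-++ {xs = []} {ys = ys} _ _ = ys , ↭-refl
Unique-⊆⇒↭-++ {xs = x ∷ xs} (x∉xs ∷ u) xs⊆ys with ∈-∃++ (xs⊆ys (here refl))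
... | as , bs , refl with Unique-⊆⇒↭-++ u xs⊆as++bs
  where
  xs⊆as++bs : xs ⊆ as ++ bs
  xs⊆as++bs z∈xs with ∈-++⁻ as (xs⊆ys (there z∈xs))
  ... | inj₁ z∈as = ∈-++⁺ˡ z∈as
  ... | inj₂ (here refl) = ⊥-elim (All.lookup x∉xs z∈xs refl)
  ... | inj₂ (there z∈bs) = ∈-++⁺ʳ as z∈bs
... | zs , p = zs , ↭-trans (↭-prep x p) (↭-sym (shift x as bs))

Unique-⊆⇒length≤ : Unique xs → xs ⊆ ys → length xs ≤ length ys
Unique-⊆⇒length≤ {xs = xs} u xs⊆ys with zs , p ← Unique-⊆⇒↭-++ u xs⊆ys =
  subst (length xs ≤_) (trans (sym (length-++ xs)) (↭-length p)) (m≤m+n (length xs) (length zs))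

Unique-⊆⇒↭ : Unique xs → xs ⊆ ys → length ys ≤ length xs → xs ↭ ys
Unique-⊆⇒↭ {xs = xs} {ys} u xs⊆ys ys≤xs with Unique-⊆⇒↭-++ u xs⊆ys
... | [] , p = subst (_↭ _) (++-identityʳ xs) p
... | _ ∷ zs , p = ⊥-elim (<⇒≱ xs<ys ys≤xs)
  where
  xs<ys : length xs < length ys
  xs<ys = subst (length xs <_) (trans (sym (length-++ xs)) (↭-length p)) (m<m+n (length xs) z<s)

Unique-∷ʳ⇒∉ : Unique (xs ++ [ y ]) → y ∉ xs
Unique-∷ʳ⇒∉ {xs = xs} {y = y} u =
  Unique.Unique[x∷xs]⇒x∉xs (Unique-resp-↭ (↭-sym (∷↭∷ʳ y xs)) u)

Unique-concatMap : {l : List A} (f : A → List B) → Unique l → All (Unique ∘ f) l →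
  (∀ {x x′ y} → x ∈ l → x′ ∈ l → y ∈ f x → y ∈ f x′ → x ≡ x′) → Unique (concatMap f l)
Unique-concatMap f [] [] _ = []
Unique-concatMap f (x∉ ∷ u) (ux ∷ us) disjoint =
  Unique.++⁺ ux (Unique-concatMap f u us (λ x∈ x′∈ → disjoint (there x∈) (there x′∈)))
    λ (y∈fx , y∈rest) → let x′ , x′∈ , y∈fx′ = find (∈-concatMap⁻ f y∈rest)
                        in All.lookup x∉ x′∈ (disjoint (here refl) (there x′∈) y∈fx y∈fx′)

map-≡⇒≗ : {f g : A → B} (xs : List A) → map f xs ≡ map g xs → ∀ {x} → x ∈ xs → f x ≡ g x
map-≡⇒≗ (_ ∷ xs) eq (here refl) = ∷-injectiveˡ eq
map-≡⇒≗ (_ ∷ xs) eq (there x∈) = map-≡⇒≗ xs (∷-injectiveʳ eq) x∈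

module _ {P : Pred A 0ℓ} (P? : Decidable P) where

  filter-separated : All P xs → All (∁ P) ys → filter P? (xs ++ ys) ≡ xs
  filter-separated {xs = xs} {ys} pxs ¬pys =
    trans (filter-++ P? xs ys)
          (trans (cong₂ _++_ (filter-all P? pxs) (filter-none P? ¬pys)) (++-identityʳ xs))

  ↭-separated : All P xs → All (∁ P) ys → All P us → All (∁ P) vs →
    xs ++ ys ↭ us ++ vs → xs ↭ us × ys ↭ vs
  ↭-separated pxs ¬pys pus ¬pvs p =
    subst₂ _↭_ (filter-separated pxs ¬pys) (filter-separated pus ¬pvs) (filter-↭ P? p) ,
    subst₂ _↭_ (complement pxs ¬pys) (complement pus ¬pvs) (filter-↭ (¬? ∘ P?) p)
    where
    complement : ∀ {xs ys} → All P xs → All (∁ P) ys → filter (¬? ∘ P?) (xs ++ ys) ≡ ys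
    complement {xs} {ys} pxs ¬pys = trans (filter-++ (¬? ∘ P?) xs ys)
      (cong₂ _++_ (filter-none (¬? ∘ P?) (All.map (λ px ¬px → ¬px px) pxs))
                  (filter-all (¬? ∘ P?) ¬pys))

  takeWhile-separated : All P xs → All (∁ P) ys → takeWhile P? (xs ++ ys) ≡ xs
  takeWhile-separated {ys = []} [] [] = refl
  takeWhile-separated {ys = y ∷ ys} [] (¬py ∷ _) rewrite dec-false (P? y) ¬py = refl
  takeWhile-separated {xs = x ∷ xs} (px ∷ pxs) ¬pys rewrite dec-true (P? x) px =
    cong (x ∷_) (takeWhile-separated pxs ¬pys)

  dropWhile-separated : All P xs → All (∁ P) ys → dropWhile P? (xs ++ ys) ≡ ys
  dropWhile-separated {ys = []} [] [] = refl
  dropWhile-separated {ys = y ∷ ys} [] (¬py ∷ _) rewrite dec-false (P? y) ¬py = refl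
  dropWhile-separated {xs = x ∷ xs} (px ∷ pxs) ¬pys rewrite dec-true (P? x) px =
    dropWhile-separated pxs ¬pys

-- Counting

count-++ : (p : A → Bool) (xs ys : List A) → count p (xs ++ ys) ≡ count p xs + count p ys
count-++ p [] ys = refl
count-++ p (x ∷ xs) ys =
  trans (cong ((if p x then 1 else 0) +_) (count-++ p xs ys)) (sym (+-assoc (if p x then 1 else 0) _ _))

count-map : (p : B → Bool) (f : A → B) (xs : List A) → count p (map f xs) ≡ count (p ∘ f) xs
count-map p f [] = refl
count-map p f (x ∷ xs) = cong ((if p (f x) then 1 else 0) +_) (count-map p f xs)

count≡length-filterᵇ : (p : A → Bool) (xs : List A) → count p xs ≡ length (filterᵇ p xs)
count≡length-filterᵇ p [] = refl
count≡length-filterᵇ p (x ∷ xs) with p x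
... | true = cong suc (count≡length-filterᵇ p xs)
... | false = count≡length-filterᵇ p xs

count-cartesianProduct : (p : A → Bool) (q : B → Bool) (xs : List A) (ys : List B) →
  count (λ xy → p (proj₁ xy) ∧ q (proj₂ xy)) (cartesianProduct xs ys) ≡ count p xs * count q ys
count-cartesianProduct p q [] ys = refl
count-cartesianProduct p q (x ∷ xs) ys = begin
  count pq (map (x ,_) ys ++ cartesianProduct xs ys)
    ≡⟨ count-++ pq (map (x ,_) ys) _ ⟩
  count pq (map (x ,_) ys) + count pq (cartesianProduct xs ys)
    ≡⟨ cong₂ _+_ (trans (count-map pq (x ,_) ys) (row (p x))) (count-cartesianProduct p q xs ys) ⟩
  (if p x then 1 else 0) * count q ys + count p xs * count q ys
    ≡⟨ *-distribʳ-+ (count q ys) (if p x then 1 else 0) (count p xs) ⟨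
  count p (x ∷ xs) * count q ys ∎
  where
  open ≡-Reasoning
  pq = λ xy → p (proj₁ xy) ∧ q (proj₂ xy)
  row : ∀ b → count (λ y → b ∧ q y) ys ≡ (if b then 1 else 0) * count q ys
  row true = sym (+-identityʳ _)
  row false = count-false ys
    where
    count-false : ∀ (ys : List B) → count (λ _ → false) ys ≡ 0
    count-false [] = refl
    count-false (y ∷ ys) = count-false ys

count-≤-by-injection : {X : List A} {Y : List B} (p : A → Bool) (q : B → Bool)
  (f : A → B) (g : B → A) → Unique X →
  (∀ {x} → x ∈ X → T (p x) → f x ∈ Y × T (q (f x)) × g (f x) ≡ x) →
  count p X ≤ count q Y
count-≤-by-injection {X = X} {Y} p q f g uX into = begin
  count p X              ≡⟨ count≡length-filterᵇ p X ⟩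
  length X′              ≡⟨ length-map f X′ ⟨
  length (map f X′)      ≤⟨ Unique-⊆⇒length≤ (Unique.map⁻ (subst Unique (sym g∘f≡id) uX′)) fX′⊆Y′ ⟩
  length (filterᵇ q Y)   ≡⟨ count≡length-filterᵇ q Y ⟨
  count q Y              ∎
  where
  open ≤-Reasoning
  X′ = filterᵇ p X
  uX′ : Unique X′
  uX′ = Unique.filter⁺ _ uX
  into′ : ∀ {x} → x ∈ X′ → f x ∈ Y × T (q (f x)) × g (f x) ≡ x
  into′ x∈ = let x∈X , px = ∈-filter⁻ _ x∈ in into x∈X px
  g∘f≡id : map g (map f X′) ≡ X′
  g∘f≡id = trans (sym (map-∘ X′)) (map-id-local (All.tabulate (proj₂ ∘ proj₂ ∘ into′)))
  fX′⊆Y′ : map f X′ ⊆ filterᵇ q Y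
  fX′⊆Y′ y∈ with x , x∈ , refl ← ∈-map⁻ f y∈ =
    let fx∈Y , qfx , _ = into′ x∈ in ∈-filter⁺ _ fx∈Y qfx

count-bijection : {X : List A} {Y : List B} (p : A → Bool) (q : B → Bool)
  (f : A → B) (g : B → A) → Unique X → Unique Y →
  (∀ {x} → x ∈ X → T (p x) → f x ∈ Y × T (q (f x)) × g (f x) ≡ x) →
  (∀ {y} → y ∈ Y → T (q y) → g y ∈ X × T (p (g y)) × f (g y) ≡ y) →
  count p X ≡ count q Y
count-bijection p q f g uX uY into onto =
  ≤-antisym (count-≤-by-injection p q f g uX into) (count-≤-by-injection q p g f uY onto)

sumFrom : ℕ → ℕ → (ℕ → ℕ) → ℕ
sumFrom i zero f = 0
sumFrom i (suc r) f = f i + sumFrom (suc i) r f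

sumFromTo-step : ∀ f i hi → i ≤ hi → sumFromTo i hi f ≡ f i + sumFromTo (suc i) hi f
sumFromTo-step f i hi i≤hi rewrite +-∸-assoc 1 i≤hi = refl

sumFromTo-empty : ∀ f hi → sumFromTo (suc hi) hi f ≡ 0
sumFromTo-empty f hi rewrite n∸n≡0 hi = refl

sumFromTo≡sumFrom : ∀ f r i hi → r + i ≡ suc hi → sumFromTo i hi f ≡ sumFrom i r f
sumFromTo≡sumFrom f zero i hi refl = sumFromTo-empty f hi
sumFromTo≡sumFrom f (suc r) i hi eq =
  trans (sumFromTo-step f i hi (subst (i ≤_) (suc-injective eq) (m≤n+m i r)))
        (cong (f i +_) (sumFromTo≡sumFrom f r (suc i) hi (trans (+-suc r i) eq)))

sumFrom-cong : (∀ {j} → i ≤ j → j < i + r → f j ≡ g j) → sumFrom i r f ≡ sumFrom i r g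
sumFrom-cong {r = zero} f≗g = refl
sumFrom-cong {i} {suc r} f≗g =
  cong₂ _+_ (f≗g ≤-refl (m<m+n i z<s))
            (sumFrom-cong (λ {j} i<j j<i+r → f≗g (<⇒≤ i<j) (subst (j <_) (sym (+-suc i r)) j<i+r)))

sumFrom-+ : ∀ i r → sumFrom i r (λ j → f j + g j) ≡ sumFrom i r f + sumFrom i r g
sumFrom-+ i zero = refl
sumFrom-+ {f} {g} i (suc r) rewrite sumFrom-+ {f} {g} (suc i) r =
  interchange (f i) (g i) (sumFrom (suc i) r f) (sumFrom (suc i) r g)

sumFrom-0 : ∀ i r → sumFrom i r (λ _ → 0) ≡ 0
sumFrom-0 i zero = refl
sumFrom-0 i (suc r) = sumFrom-0 (suc i) r

≡ᵇ-refl : ∀ n → (n ≡ᵇ n) ≡ true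
≡ᵇ-refl zero = refl
≡ᵇ-refl (suc n) = ≡ᵇ-refl n

≡ᵇ-≢ : ∀ {m n} → m ≢ n → (m ≡ᵇ n) ≡ false
≡ᵇ-≢ {m} {n} m≢n with m ≡ᵇ n in e
... | true = ⊥-elim (m≢n (≡ᵇ⇒≡ m n (subst T (sym e) tt)))
... | false = refl

indicator : ℕ → ℕ → ℕ
indicator h j = if h ≡ᵇ j then 1 else 0

sumFrom-indicator-below : ∀ i r → h < i → sumFrom i r (indicator h) ≡ 0
sumFrom-indicator-below i zero h<i = refl
sumFrom-indicator-below i (suc r) h<i rewrite ≡ᵇ-≢ (<⇒≢ h<i) =
  sumFrom-indicator-below (suc i) r (m<n⇒m<1+n h<i)

sumFrom-indicator : ∀ i r → i ≤ h → h < i + r → sumFrom i r (indicator h) ≡ 1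
sumFrom-indicator i zero i≤h h<i+0 = ⊥-elim (<⇒≱ (subst (_ <_) (+-identityʳ i) h<i+0) i≤h)
sumFrom-indicator {h} i (suc r) i≤h h<i+r with m≤n⇒m<n∨m≡n i≤h
... | inj₂ refl rewrite ≡ᵇ-refl h = cong suc (sumFrom-indicator-below (suc h) r ≤-refl)
... | inj₁ i<h rewrite ≡ᵇ-≢ (>⇒≢ i<h) =
  sumFrom-indicator (suc i) r i<h (subst (h <_) (+-suc i r) h<i+r)

count-partition : (P : A → Bool) (Q : ℕ → A → Bool) (key : A → ℕ) (X : List A) (i r : ℕ) →
  (∀ {x} → x ∈ X → T (P x) → i ≤ key x × key x < i + r × (∀ j → Q j x ≡ (key x ≡ᵇ j))) →
  count P X ≡ sumFrom i r (λ j → count (λ x → P x ∧ Q j x) X)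
count-partition P Q key [] i r _ = sym (sumFrom-0 i r)
count-partition P Q key (x ∷ X) i r keyed = begin
  (if P x then 1 else 0) + count P X
    ≡⟨ cong₂ _+_ head (count-partition P Q key X i r (keyed ∘ there)) ⟩
  sumFrom i r (λ j → if P x ∧ Q j x then 1 else 0) +
  sumFrom i r (λ j → count (λ x → P x ∧ Q j x) X)
    ≡⟨ sumFrom-+ i r ⟨
  sumFrom i r (λ j → count (λ x → P x ∧ Q j x) (x ∷ X)) ∎
  where
  open ≡-Reasoning
  head : (if P x then 1 else 0) ≡ sumFrom i r (λ j → if P x ∧ Q j x then 1 else 0)
  head with P x in e
  ... | false = sym (sumFrom-0 i r)
  ... | true with i≤key , key<i+r , Q≡ ← keyed (here refl) (subst T (sym e) tt) = sym (begin
    sumFrom i r (λ j → if Q j x then 1 else 0)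
      ≡⟨ sumFrom-cong {i = i} {r} (λ {j} _ _ → cong (λ b → if b then 1 else 0) (Q≡ j)) ⟩
    sumFrom i r (indicator (key x))
      ≡⟨ sumFrom-indicator i r i≤key key<i+r ⟩
    1 ∎)

-- Permutations of 1, …, n

range : ℕ → List ℕ
range = applyUpTo suc

∈-range⁺ : 1 ≤ x → x ≤ n → x ∈ range n
∈-range⁺ {x = suc i} _ i<n = ∈-applyUpTo⁺ suc i<n

∈-range⁻ : x ∈ range n → 1 ≤ x × x ≤ n
∈-range⁻ x∈ with i , i<n , refl ← ∈-applyUpTo⁻ suc x∈ = s≤s z≤n , i<n

Unique-range : ∀ n → Unique (range n)
Unique-range n = Unique.applyUpTo⁺₁ suc n (λ i<j _ → <⇒≢ i<j ∘ suc-injective)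

length-range : ∀ n → length (range n) ≡ n
length-range = length-applyUpTo suc

range-suc : ∀ m → range (suc m) ≡ 1 ∷ map suc (range m)
range-suc m = cong (1 ∷_) (sym (map-applyUpTo suc suc m))

range-+ : ∀ m n → range (m + n) ≡ range m ++ map (m +_) (range n)
range-+ zero n = sym (map-id (range n))
range-+ (suc m) n = begin
  range (suc (m + n))
    ≡⟨ range-suc (m + n) ⟩
  1 ∷ map suc (range (m + n))
    ≡⟨ cong (λ l → 1 ∷ map suc l) (range-+ m n) ⟩
  1 ∷ map suc (range m ++ map (m +_) (range n))
    ≡⟨ cong (1 ∷_) (map-++ suc (range m) _) ⟩
  1 ∷ map suc (range m) ++ map suc (map (m +_) (range n))
    ≡⟨ cong (λ l → 1 ∷ map suc (range m) ++ l) (map-∘ (range n)) ⟨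
  1 ∷ map suc (range m) ++ map (suc m +_) (range n)
    ≡⟨ cong (_++ map (suc m +_) (range n)) (range-suc m) ⟨
  range (suc m) ++ map (suc m +_) (range n) ∎
  where open ≡-Reasoning

∈-insertions⁻ : ∀ {y} → y ∈ insertions x l → ∃₂ λ as bs → l ≡ as ++ bs × y ≡ as ++ x ∷ bs
∈-insertions⁻ {l = []} (here refl) = [] , [] , refl , refl
∈-insertions⁻ {l = z ∷ l} (here refl) = [] , z ∷ l , refl , refl
∈-insertions⁻ {l = z ∷ l} (there y∈) with y′ , y′∈ , refl ← ∈-map⁻ (z ∷_) y∈
  with as , bs , refl , refl ← ∈-insertions⁻ y′∈ = z ∷ as , bs , refl , refl

∈-insertions⁺ : ∀ x as bs → as ++ x ∷ bs ∈ insertions x (as ++ bs)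
∈-insertions⁺ x [] [] = here refl
∈-insertions⁺ x [] (b ∷ bs) = here refl
∈-insertions⁺ x (a ∷ as) bs = there (∈-map⁺ (a ∷_) (∈-insertions⁺ x as bs))

Unique-insertions : x ∉ l → Unique (insertions x l)
Unique-insertions {l = []} _ = [] ∷ []
Unique-insertions {x} {z ∷ l} x∉ =
  All.tabulate fresh-head ∷ Unique.map⁺ ∷-injectiveʳ (Unique-insertions (x∉ ∘ there))
  where
  fresh-head : ∀ {y} → y ∈ map (z ∷_) (insertions x l) → x ∷ z ∷ l ≢ y
  fresh-head y∈ eq with _ , _ , refl ← ∈-map⁻ (z ∷_) y∈ = x∉ (here (∷-injectiveˡ eq))

∷-middle-injective : x ∉ as → x ∉ cs → as ++ x ∷ bs ≡ cs ++ x ∷ ds → as ++ bs ≡ cs ++ ds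
∷-middle-injective {as = []} {cs = []} _ _ eq = ∷-injectiveʳ eq
∷-middle-injective {as = []} {cs = c ∷ cs} _ x∉ eq = ⊥-elim (x∉ (here (∷-injectiveˡ eq)))
∷-middle-injective {as = a ∷ as} {cs = []} x∉ _ eq = ⊥-elim (x∉ (here (sym (∷-injectiveˡ eq))))
∷-middle-injective {as = a ∷ as} {cs = c ∷ cs} x∉ x∉′ eq =
  cong₂ _∷_ (∷-injectiveˡ eq) (∷-middle-injective (x∉ ∘ there) (x∉′ ∘ there) (∷-injectiveʳ eq))

insertions-disjoint : ∀ {l′ y} → x ∉ l → x ∉ l′ → y ∈ insertions x l → y ∈ insertions x l′ → l ≡ l′
insertions-disjoint x∉l x∉l′ y∈ y∈′
  with as , bs , refl , refl ← ∈-insertions⁻ y∈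
  with cs , ds , refl , eq ← ∈-insertions⁻ y∈′ =
  ∷-middle-injective (x∉l ∘ ∈-++⁺ˡ) (x∉l′ ∘ ∈-++⁺ˡ) eq

∈-perms⁻ : l ∈ perms n → l ↭ range n
∈-perms⁻ {n = zero} (here refl) = ↭-refl
∈-perms⁻ {n = suc n} l∈ with l′ , l′∈ , l∈ins ← find (∈-concatMap⁻ (insertions (suc n)) l∈)
                        with as , bs , refl , refl ← ∈-insertions⁻ l∈ins = begin
  as ++ [ suc n ] ++ bs  ↭⟨ shift (suc n) as bs ⟩
  suc n ∷ as ++ bs       ↭⟨ ↭-prep (suc n) (∈-perms⁻ l′∈) ⟩
  suc n ∷ range n        ↭⟨ ∷↭∷ʳ (suc n) (range n) ⟩
  range n ++ [ suc n ]   ≡⟨ applyUpTo-∷ʳ suc n ⟩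
  range (suc n)          ∎
  where open PermutationReasoning

∈-perms⁺ : l ↭ range n → l ∈ perms n
∈-perms⁺ {n = zero} p rewrite ↭-empty-inv p = here refl
∈-perms⁺ {n = suc n} p with as , bs , refl ← ∈-∃++ (∈-resp-↭ (↭-sym p) (∈-range⁺ (s≤s z≤n) ≤-refl)) =
  ∈-concatMap⁺ (insertions (suc n)) (lose (∈-perms⁺ as++bs↭) (∈-insertions⁺ (suc n) as bs))
  where
  as++bs↭ : as ++ bs ↭ range n
  as++bs↭ = subst (as ++ bs ↭_) (++-identityʳ (range n))
    (drop-mid as (range n) (subst (as ++ [ suc n ] ++ bs ↭_) (sym (applyUpTo-∷ʳ suc n)) p))

length-perms : l ∈ perms n → length l ≡ n
length-perms {n = n} l∈ = trans (↭-length (∈-perms⁻ {n = n} l∈)) (length-range n)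

perms-fresh : l ∈ perms n → suc n ∉ l
perms-fresh {n = n} l∈ sn∈ = 1+n≰n (proj₂ (∈-range⁻ (∈-resp-↭ (∈-perms⁻ {n = n} l∈) sn∈)))

Unique-perms : ∀ n → Unique (perms n)
Unique-perms zero = [] ∷ []
Unique-perms (suc n) = Unique-concatMap (insertions (suc n)) (Unique-perms n)
  (All.tabulate (Unique-insertions ∘ perms-fresh {n = n}))
  (λ l∈ l′∈ → insertions-disjoint (perms-fresh {n = n} l∈) (perms-fresh {n = n} l′∈))

-- Subsequences and patterns

AllPairs-resp-⊑ : {R : Rel A 0ℓ} → xs ⊑ ys → AllPairs R ys → AllPairs R xs
AllPairs-resp-⊑ [] [] = []
AllPairs-resp-⊑ (y ∷ʳ τ) (_ ∷ rys) = AllPairs-resp-⊑ τ rys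
AllPairs-resp-⊑ (refl ∷ τ) (ry ∷ rys) = All-resp-⊆ τ ry ∷ AllPairs-resp-⊑ τ rys

⊑-++⁻ : ∀ (xs : List A) {ys t} → t ⊑ xs ++ ys → ∃₂ λ t₁ t₂ → t ≡ t₁ ++ t₂ × t₁ ⊑ xs × t₂ ⊑ ys
⊑-++⁻ [] τ = [] , _ , refl , [] , τ
⊑-++⁻ (x ∷ xs) (.x ∷ʳ τ) with t₁ , t₂ , refl , τ₁ , τ₂ ← ⊑-++⁻ xs τ = t₁ , t₂ , refl , x ∷ʳ τ₁ , τ₂
⊑-++⁻ (x ∷ xs) (refl ∷ τ) with t₁ , t₂ , refl , τ₁ , τ₂ ← ⊑-++⁻ xs τ = x ∷ t₁ , t₂ , refl , refl ∷ τ₁ , τ₂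

⊑-map⁻ : ∀ (f : A → B) xs {t} → t ⊑ map f xs → ∃[ t′ ] t′ ⊑ xs × t ≡ map f t′
⊑-map⁻ f [] [] = [] , [] , refl
⊑-map⁻ f (x ∷ xs) (.(f x) ∷ʳ τ) with t′ , τ′ , refl ← ⊑-map⁻ f xs τ = t′ , x ∷ʳ τ′ , refl
⊑-map⁻ f (x ∷ xs) (refl ∷ τ) with t′ , τ′ , refl ← ⊑-map⁻ f xs τ = x ∷ t′ , refl ∷ τ′ , refl

∈-subseqs⁻ : ∀ m s → t ∈ subseqs m s → t ⊑ s × length t ≡ m
∈-subseqs⁻ zero s (here refl) = minimum s , refl
∈-subseqs⁻ (suc m) (x ∷ s) t∈ with ∈-++⁻ (map (x ∷_) (subseqs m s)) t∈
... | inj₂ t∈′ = let τ , len = ∈-subseqs⁻ (suc m) s t∈′ in x ∷ʳ τ , len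
... | inj₁ t∈′ with t′ , t′∈ , refl ← ∈-map⁻ (x ∷_) t∈′ =
  let τ , len = ∈-subseqs⁻ m s t′∈ in refl ∷ τ , cong suc len

∈-subseqs⁺ : t ⊑ s → t ∈ subseqs (length t) s
∈-subseqs⁺ [] = here refl
∈-subseqs⁺ {t = []} (y ∷ʳ τ) = here refl
∈-subseqs⁺ {t = x ∷ t} (y ∷ʳ τ) = ∈-++⁺ʳ (map (y ∷_) (subseqs (length t) _)) (∈-subseqs⁺ τ)
∈-subseqs⁺ (refl ∷ τ) = ∈-++⁺ˡ (∈-map⁺ (_ ∷_) (∈-subseqs⁺ τ))

T-not : ∀ {b} → T (not b) ⇔ (¬ T b)
T-not {true} = mk⇔ (λ ()) (λ ¬tt → ¬tt tt)
T-not {false} = mk⇔ (λ _ ()) (λ _ → tt)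

T-allᵇ : ∀ {p : A → Bool} {xs} → T (allᵇ p xs) ⇔ All (T ∘ p) xs
T-allᵇ {xs = []} = mk⇔ (λ _ → []) (λ _ → tt)
T-allᵇ {xs = x ∷ xs} = mk⇔
  (λ h → let px , pxs = to T-∧ h in px ∷ to T-allᵇ pxs)
  (λ { (px ∷ pxs) → from T-∧ (px , from T-allᵇ pxs) })

T-anyᵇ⁻ : ∀ (p : A → Bool) xs → T (anyᵇ p xs) → ∃[ x ] x ∈ xs × T (p x)
T-anyᵇ⁻ p (x ∷ xs) h with to T-∨ h
... | inj₁ px = x , here refl , px
... | inj₂ h′ = let y , y∈ , py = T-anyᵇ⁻ p xs h′ in y , there y∈ , py

T-anyᵇ⁺ : ∀ (p : A → Bool) {xs x} → x ∈ xs → T (p x) → T (anyᵇ p xs)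
T-anyᵇ⁺ p (here refl) px = from T-∨ (inj₁ px)
T-anyᵇ⁺ p (there x∈) px = from T-∨ (inj₂ (T-anyᵇ⁺ p x∈ px))

T-elemᵇ : T (elemᵇ x xs) ⇔ x ∈ xs
T-elemᵇ {xs = []} = mk⇔ (λ ()) (λ ())
T-elemᵇ {x} {y ∷ xs} = mk⇔
  (λ h → [ here ∘ ≡ᵇ⇒≡ x y , there ∘ to T-elemᵇ ]′ (to T-∨ h))
  (λ { (here refl) → from T-∨ (inj₁ (≡⇒≡ᵇ x x refl))
      ; (there x∈) → from T-∨ (inj₂ (from T-elemᵇ x∈)) })

T-distinctᵇ : T (distinctᵇ xs) ⇔ Unique xs
T-distinctᵇ {[]} = mk⇔ (λ _ → []) (λ _ → tt)
T-distinctᵇ {x ∷ xs} = mk⇔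
  (λ h → let fresh , u = to T-∧ h
         in ¬Any⇒All¬ xs (to T-not fresh ∘ from T-elemᵇ) ∷ to T-distinctᵇ u)
  (λ { (fresh ∷ u) → from T-∧ (from T-not (All¬⇒¬Any fresh ∘ to T-elemᵇ) , from T-distinctᵇ u) })

<ᵇ-true : ∀ {m n} → m < n → (m <ᵇ n) ≡ true
<ᵇ-true m<n = to T-≡ (<⇒<ᵇ m<n)

<ᵇ-false : ∀ {m n} → n ≤ m → (m <ᵇ n) ≡ false
<ᵇ-false {m} {n} n≤m with m <ᵇ n in e
... | true = ⊥-elim (<⇒≱ (<ᵇ⇒< m n (subst T (sym e) tt)) n≤m)
... | false = refl

T-contains⁻ : ∀ σ s → T (contains σ s) → ∃[ t ] t ⊑ s × length t ≡ length σ × T (orderIso t σ)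
T-contains⁻ σ s h with t , t∈ , o ← T-anyᵇ⁻ (λ t → orderIso t σ) (subseqs (length σ) s) h =
  let τ , len = ∈-subseqs⁻ (length σ) s t∈ in t , τ , len , o

T-contains⁺ : ∀ σ → t ⊑ s → length t ≡ length σ → T (orderIso t σ) → T (contains σ s)
T-contains⁺ {t = t} {s} σ τ len o =
  T-anyᵇ⁺ (λ t → orderIso t σ) (subst (λ m → t ∈ subseqs m s) len (∈-subseqs⁺ τ)) o

Decreasing : List ℕ → Set
Decreasing = AllPairs _>_

HasDecreasing : ℕ → List ℕ → Set
HasDecreasing k s = ∃[ t ] t ⊑ s × length t ≡ k × Decreasing t

Has213 : List ℕ → Set
Has213 s = ∃[ p ] ∃[ q ] ∃[ r ] (p ∷ q ∷ r ∷ []) ⊑ s × q < p × p < r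

-- orderIso compares entries through a where-bound function, which cannot be named;
-- agreements reproduces it.
agreements : ℕ → ℕ → List ℕ → List ℕ → List Bool
agreements x y [] [] = []
agreements x y (u ∷ us) (v ∷ vs) = (ltAgree x u y v ∧ ltAgree u x v y) ∷ agreements x y us vs
agreements x y (u ∷ us) [] = false ∷ []
agreements x y [] (v ∷ vs) = false ∷ []

orderIso-∷ : ∀ x y s t → orderIso (x ∷ s) (y ∷ t) ≡ allᵇ id (agreements x y s t) ∧ orderIso s t
orderIso-∷ x y [] [] = refl
orderIso-∷ x y [] (v ∷ t) = refl
orderIso-∷ x y (u ∷ s) [] = refl
orderIso-∷ x y (u ∷ s) (v ∷ t) with orderIso (u ∷ s) (v ∷ t) in eq
... | false = trans (∧-zeroʳ _) (sym (∧-zeroʳ _))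
... | true = cong (λ b → ((ltAgree x u y v ∧ ltAgree u x v y) ∧ b) ∧ true)
                  (∧-cancelʳ (orderIso-∷ x y s t) rest)
  where
  rest : orderIso s t ≡ true
  rest = ∧-conicalʳ _ _ (trans (sym (orderIso-∷ u v s t)) eq)
  ∧-cancelʳ : ∀ {b b′ o} → b ∧ o ≡ b′ ∧ o → o ≡ true → b ≡ b′
  ∧-cancelʳ {b} {b′} e refl = trans (sym (∧-identityʳ b)) (trans e (∧-identityʳ b′))

agree-below : ∀ {x y u v} → v < y → (ltAgree x u y v ∧ ltAgree u x v y) ≡ (u <ᵇ x)
agree-below {x} {y} {u} {v} v<y rewrite <ᵇ-false (<⇒≤ v<y) | <ᵇ-true v<y with u <ᵇ x in e
... | false = ∧-zeroʳ _
... | true rewrite <ᵇ-false (<⇒≤ (<ᵇ⇒< u x (subst T (sym e) tt))) = refl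

allᵇ-agreements-below : ∀ x {y} s {t} → All (_< y) t → length s ≡ length t →
  allᵇ id (agreements x y s t) ≡ allᵇ (_<ᵇ x) s
allᵇ-agreements-below x [] [] _ = refl
allᵇ-agreements-below x (u ∷ s) (v<y ∷ t<y) len =
  cong₂ _∧_ (agree-below {x} {u = u} v<y) (allᵇ-agreements-below x s t<y (suc-injective len))

length-δ : ∀ k → length (δ k) ≡ k
length-δ zero = refl
length-δ (suc k) = cong suc (length-δ k)

δ-below : ∀ k → All (_< suc k) (δ k)
δ-below zero = []
δ-below (suc k) = ≤-refl ∷ All.map m<n⇒m<1+n (δ-below k)

orderIso-δ : ∀ t → T (orderIso t (δ (length t))) ⇔ Decreasing t
orderIso-δ [] = mk⇔ (λ _ → []) (λ _ → tt)
orderIso-δ (x ∷ s) = mk⇔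
  (λ h → let h₁ , h₂ = to T-∧ (subst T unfold h)
         in All.map (<ᵇ⇒< _ _) (to T-allᵇ h₁) ∷ to (orderIso-δ s) h₂)
  (λ { (s<x ∷ ds) →
       subst T (sym unfold) (from T-∧ (from T-allᵇ (All.map <⇒<ᵇ s<x) , from (orderIso-δ s) ds)) })
  where
  unfold : orderIso (x ∷ s) (δ (suc (length s))) ≡ allᵇ (_<ᵇ x) s ∧ orderIso s (δ (length s))
  unfold = trans (orderIso-∷ x _ s (δ (length s)))
                 (cong (_∧ _) (allᵇ-agreements-below x s (δ-below (length s)) (sym (length-δ (length s)))))

T-contains-δ : T (contains (δ k) s) ⇔ HasDecreasing k s
T-contains-δ {k} {s} = mk⇔
  (λ h → let t , τ , len , o = T-contains⁻ (δ k) s h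
             len′ = trans len (length-δ k)
         in t , τ , len′ , to (orderIso-δ t) (subst (λ k → T (orderIso t (δ k))) (sym len′) o))
  (λ { (t , τ , refl , d) → T-contains⁺ (δ (length t)) τ (sym (length-δ _)) (from (orderIso-δ t) d) })

orderIso-213⁻ : ∀ p q r → T (orderIso (p ∷ q ∷ r ∷ []) p213) → q < p × p < r
orderIso-213⁻ p q r h with p <ᵇ q | q <ᵇ p in q<p | p <ᵇ r in p<r
... | false | true | true = <ᵇ⇒< q p (subst T (sym q<p) tt) , <ᵇ⇒< p r (subst T (sym p<r) tt)
... | true | _ | _ = ⊥-elim h
... | false | false | _ = ⊥-elim h
... | false | true | false = ⊥-elim h

orderIso-213⁺ : ∀ {p q r} → q < p → p < r → T (orderIso (p ∷ q ∷ r ∷ []) p213)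
orderIso-213⁺ q<p p<r
  rewrite <ᵇ-false (<⇒≤ q<p) | <ᵇ-true q<p | <ᵇ-true p<r | <ᵇ-false (<⇒≤ p<r)
        | <ᵇ-true (<-trans q<p p<r) | <ᵇ-false (<⇒≤ (<-trans q<p p<r)) = tt

T-contains-213 : T (contains p213 s) ⇔ Has213 s
T-contains-213 {s} = mk⇔
  (λ h → occurrence (T-contains⁻ p213 s h))
  (λ (p , q , r , τ , q<p , p<r) → T-contains⁺ p213 τ refl (orderIso-213⁺ q<p p<r))
  where
  occurrence : (∃[ t ] t ⊑ s × length t ≡ 3 × T (orderIso t p213)) → Has213 s
  occurrence (p ∷ q ∷ r ∷ [] , τ , _ , o) = p , q , r , τ , orderIso-213⁻ p q r o

T-goodA : ∀ k π → T (goodA k π) ⇔ (T (isCyclic π) × ¬ HasDecreasing k π × ¬ Has213 (cycleForm π))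
T-goodA k π = mk⇔
  (λ h → let cyclic , rest = to T-∧ h ; noδ , no213 = to T-∧ rest in
         cyclic , to T-not noδ ∘ from T-contains-δ , to T-not no213 ∘ from T-contains-213)
  (λ (cyclic , noδ , no213) →
     from T-∧ (cyclic , from T-∧ (from T-not (noδ ∘ to T-contains-δ) ,
                                  from T-not (no213 ∘ to T-contains-213))))

HasDecreasing-⊑ : ∀ {s s′} → s ⊑ s′ → HasDecreasing k s → HasDecreasing k s′
HasDecreasing-⊑ σ (t , τ , len , dec) = t , ⊆-trans τ σ , len , dec

Has213-⊑ : ∀ {s s′} → s ⊑ s′ → Has213 s → Has213 s′
Has213-⊑ σ (p , q , r , τ , q<p , p<r) = p , q , r , ⊆-trans τ σ , q<p , p<r

module _ {f : ℕ → ℕ} (mono : f Preserves _<_ ⟶ _<_) where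

  reflect-< : ∀ {u v} → f u < f v → u < v
  reflect-< {u} {v} fu<fv with <-cmp u v
  ... | tri< u<v _ _ = u<v
  ... | tri≈ _ refl _ = ⊥-elim (<-irrefl refl fu<fv)
  ... | tri> _ _ v<u = ⊥-elim (<-asym fu<fv (mono v<u))

  HasDecreasing-map⁺ : HasDecreasing k s → HasDecreasing k (map f s)
  HasDecreasing-map⁺ (t , τ , len , dec) =
    map f t , ⊑-map⁺ f τ , trans (length-map f t) len , AllPairs.map⁺ (AllPairs.map mono dec)

  HasDecreasing-map⁻ : HasDecreasing k (map f s) → HasDecreasing k s
  HasDecreasing-map⁻ {s = s} (t , τ , len , dec) with t′ , τ′ , refl ← ⊑-map⁻ f s τ =
    t′ , τ′ , trans (sym (length-map f t′)) len , AllPairs.map reflect-< (AllPairs.map⁻ dec)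

  Has213-map⁺ : Has213 s → Has213 (map f s)
  Has213-map⁺ (p , q , r , τ , q<p , p<r) = f p , f q , f r , ⊑-map⁺ f τ , mono q<p , mono p<r

  Has213-map⁻ : Has213 (map f s) → Has213 s
  Has213-map⁻ {s = s} (_ , _ , _ , τ , q<p , p<r) with p ∷ q ∷ r ∷ [] , τ′ , refl ← ⊑-map⁻ f s τ =
    p , q , r , τ′ , reflect-< q<p , reflect-< p<r

Decreasing-constant⇒⊑[x] : Decreasing t → All (_≡ x) t → t ⊑ [ x ]
Decreasing-constant⇒⊑[x] {x = x} [] [] = x ∷ʳ []
Decreasing-constant⇒⊑[x] (_ ∷ []) (refl ∷ []) = refl ∷ []
Decreasing-constant⇒⊑[x] ((u<v ∷ _) ∷ _) (refl ∷ refl ∷ _) = ⊥-elim (<-irrefl refl u<v)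

-- Once a decreasing subsequence has used an entry of P, which is ≤ J, its remaining
-- entries in Q must be x.
HasDecreasing-++⁻ : ∀ {J} P {Q} → All (_≤ J) P → All (λ z → z ≡ x ⊎ J < z) Q →
  HasDecreasing k (P ++ Q) → HasDecreasing k (P ++ [ x ]) ⊎ HasDecreasing k Q
HasDecreasing-++⁻ {x = x} P P≤J Q-shape (t , τ , len , dec) with ⊑-++⁻ P τ
... | [] , t₂ , refl , _ , τ₂ = inj₂ (t₂ , τ₂ , len , dec)
... | u ∷ t₁ , t₂ , refl , τ₁ , τ₂ =
  inj₁ (u ∷ t₁ ++ t₂ , ++⁺ τ₁ t₂⊑[x] , len , dec)
  where
  t₂<u : All (_< u) t₂
  t₂<u = All.++⁻ʳ t₁ (AllPairs.head dec)
  t₂≡x : All (_≡ x) t₂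
  t₂≡x = All.tabulate λ z∈ → [ id , (λ J<z → ⊥-elim (<-asym (All.lookup t₂<u z∈)
           (≤-<-trans (All.lookup P≤J (lookup τ₁ (here refl))) J<z))) ]′ (All.lookup Q-shape (lookup τ₂ z∈))
  t₂⊑[x] : t₂ ⊑ [ x ]
  t₂⊑[x] = Decreasing-constant⇒⊑[x] (AllPairs-resp-⊑ (++⁺ˡ (u ∷ t₁) ⊆-refl) dec) t₂≡x

Has213-∷-min : All (x ≤_) s → Has213 (x ∷ s) → Has213 s
Has213-∷-min x≤s (p , q , r , _ ∷ʳ τ , q<p , p<r) = p , q , r , τ , q<p , p<r
Has213-∷-min x≤s (_ , q , r , refl ∷ τ , q<x , _) =
  ⊥-elim (<⇒≱ q<x (All.lookup x≤s (lookup τ (here refl))))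

Has213-∷-separated : ∀ {L S} → All (j <_) L → All (_< j) S →
  Has213 (j ∷ L ++ S) → Has213 (j ∷ S) ⊎ Has213 L
Has213-∷-separated {j} {L} {S} j<L S<j = separate
  where
  above : ∀ {t z} → t ⊑ L → z ∈ t → j < z
  above τ = All.lookup j<L ∘ lookup τ
  below : ∀ {t z} → t ⊑ S → z ∈ t → z < j
  below τ = All.lookup S<j ∘ lookup τ
  separate : Has213 (j ∷ L ++ S) → Has213 (j ∷ S) ⊎ Has213 L
  separate (_ , q , r , refl ∷ τ , q<j , j<r) with ⊑-++⁻ L τ
  ... | [] , _ , refl , _ , τ₂ = ⊥-elim (<-asym j<r (below τ₂ (there (here refl))))
  ... | _ ∷ [] , _ , refl , τ₁ , _ = ⊥-elim (<-asym q<j (above τ₁ (here refl)))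
  ... | _ ∷ _ ∷ [] , [] , refl , τ₁ , _ = ⊥-elim (<-asym q<j (above τ₁ (here refl)))
  separate (p , q , r , _ ∷ʳ τ , q<p , p<r) with ⊑-++⁻ L τ
  ... | [] , _ , refl , _ , τ₂ = inj₁ (p , q , r , _ ∷ʳ τ₂ , q<p , p<r)
  ... | _ ∷ [] , _ , refl , τ₁ , τ₂ =
    ⊥-elim (<-asym p<r (<-trans (below τ₂ (there (here refl))) (above τ₁ (here refl))))
  ... | _ ∷ _ ∷ [] , _ , refl , τ₁ , τ₂ =
    ⊥-elim (<-asym p<r (<-trans (below τ₂ (here refl)) (above τ₁ (here refl))))
  ... | _ ∷ _ ∷ _ ∷ [] , [] , refl , τ₁ , _ = inj₂ (p , q , r , τ₁ , q<p , p<r)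

-- If j is followed by some x < j, every later z > j would complete the 213 occurrence j, x, z.
Has213-free⇒dropWhile-below : ∀ j s → j ∉ s → ¬ Has213 (j ∷ s) → All (_< j) (dropWhile (j <?_) s)
Has213-free⇒dropWhile-below j [] _ _ = []
Has213-free⇒dropWhile-below j (x ∷ s) j∉ no213 with j <? x
... | yes j<x rewrite dec-true (j <? x) j<x =
  Has213-free⇒dropWhile-below j s (j∉ ∘ there) (no213 ∘ Has213-⊑ (refl ∷ (x ∷ʳ ⊆-refl)))
... | no j≮x rewrite dec-false (j <? x) j≮x = x<j ∷ All.tabulate s<j
  where
  x<j : x < j
  x<j = ≤∧≢⇒< (≮⇒≥ j≮x) (λ x≡j → j∉ (here (sym x≡j)))
  s<j : ∀ {z} → z ∈ s → z < j
  s<j {z} z∈ = ≤∧≢⇒< (≮⇒≥ λ j<z → no213 (j , x , z , refl ∷ (refl ∷ from∈ z∈) , x<j , j<z))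
                     (λ z≡j → j∉ (there (subst (_∈ s) z≡j z∈)))

-- Cycles

app-applyUpTo : ∀ f n {i} → i < n → app (applyUpTo f n) (suc i) ≡ f i
app-applyUpTo f (suc n) {zero} _ = refl
app-applyUpTo f (suc n) {suc i} (s≤s i<n) = app-applyUpTo (f ∘ suc) n i<n

app-map-range : ∀ (f : ℕ → ℕ) n {p} → p ∈ range n → app (map f (range n)) p ≡ f p
app-map-range f n p∈ with i , i<n , refl ← ∈-applyUpTo⁻ suc p∈ =
  trans (cong (λ l → app l (suc i)) (map-applyUpTo suc f n)) (app-applyUpTo (f ∘ suc) n i<n)

map-app-range : ∀ l → map (app l) (range (length l)) ≡ l
map-app-range l = trans (map-applyUpTo suc (app l) (length l)) (applyUpTo-app l)
  where
  applyUpTo-app : ∀ l → applyUpTo (app l ∘ suc) (length l) ≡ l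
  applyUpTo-app [] = refl
  applyUpTo-app (x ∷ l) = cong (x ∷_) (applyUpTo-app l)

app-∈ : ∀ l {p} → p ∈ range (length l) → app l p ∈ l
app-∈ l p∈ = subst (app l _ ∈_) (map-app-range l) (∈-map⁺ (app l) p∈)

app-∷ : ∀ y xs {q} → 1 ≤ q → app (y ∷ xs) (suc q) ≡ app xs q
app-∷ y xs {suc q} _ = refl

app-++ˡ : ∀ xs {ys p} → 1 ≤ p → p ≤ length xs → app (xs ++ ys) p ≡ app xs p
app-++ˡ (x ∷ xs) {p = suc zero} _ _ = refl
app-++ˡ (x ∷ xs) {p = suc (suc p)} _ (s≤s p≤) = app-++ˡ xs (s≤s z≤n) p≤

app-++ʳ : ∀ xs {ys q} → 1 ≤ q → app (xs ++ ys) (length xs + q) ≡ app ys q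
app-++ʳ [] _ = refl
app-++ʳ (x ∷ xs) {ys} {q} 1≤q =
  trans (app-∷ x (xs ++ ys) (≤-trans 1≤q (m≤n+m q (length xs)))) (app-++ʳ xs 1≤q)

app-take : ∀ n xs {p} → 1 ≤ p → p ≤ n → app (take n xs) p ≡ app xs p
app-take zero xs {suc p} _ ()
app-take (suc n) [] _ _ = refl
app-take (suc n) (x ∷ xs) {suc zero} _ _ = refl
app-take (suc n) (x ∷ xs) {suc (suc p)} _ (s≤s p≤n) = app-take n xs (s≤s z≤n) p≤n

app-map : f 0 ≡ 0 → ∀ xs q → app (map f xs) q ≡ f (app xs q)
app-map f0≡0 [] q = sym f0≡0
app-map f0≡0 (y ∷ xs) zero = sym f0≡0
app-map f0≡0 (y ∷ xs) (suc zero) = refl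
app-map f0≡0 (y ∷ xs) (suc (suc q)) = app-map f0≡0 xs (suc q)

take-last : ∀ n xs → length xs ≡ suc n → xs ≡ take n xs ++ [ app xs (suc n) ]
take-last zero (x ∷ []) _ = refl
take-last (suc n) (x ∷ xs) len = cong (x ∷_) (take-last n xs (suc-injective len))

rotate : List ℕ → List ℕ
rotate [] = []
rotate (x ∷ xs) = xs ++ [ x ]

rotate-↭ : ∀ xs → rotate xs ↭ xs
rotate-↭ [] = ↭-refl
rotate-↭ (x ∷ xs) = ↭-sym (∷↭∷ʳ x xs)

-- c lists 1, …, n in the order of the single cycle of π.
record IsCycleOf (n : ℕ) (π c : List ℕ) : Set where
  field
    length-π : length π ≡ n
    c↭range : c ↭ range n
    rotates : map (app π) c ≡ rotate c

module _ (cyc : IsCycleOf n π c) where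
  open IsCycleOf cyc

  IsCycleOf⇒length : length c ≡ n
  IsCycleOf⇒length = trans (↭-length c↭range) (length-range n)

  IsCycleOf⇒tabulate : π ≡ map (app π) (range n)
  IsCycleOf⇒tabulate = trans (sym (map-app-range π)) (cong (map (app π) ∘ range) length-π)

  IsCycleOf⇒↭ : π ↭ range n
  IsCycleOf⇒↭ = begin
    π                      ≡⟨ IsCycleOf⇒tabulate ⟩
    map (app π) (range n)  ↭⟨ ↭-map⁺ (app π) (↭-sym c↭range) ⟩
    map (app π) c          ≡⟨ rotates ⟩
    rotate c               ↭⟨ rotate-↭ c ⟩
    c                      ↭⟨ c↭range ⟩
    range n                ∎
    where open PermutationReasoning

IsCycleOf-injective : ∀ {π′} → IsCycleOf n π c → IsCycleOf n π′ c → π ≡ π′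
IsCycleOf-injective {n} {π} {c} {π′} cyc cyc′ = begin
  π                       ≡⟨ IsCycleOf⇒tabulate cyc ⟩
  map (app π) (range n)   ≡⟨ map-cong-local (All.tabulate (map-≡⇒≗ c agree ∘ ∈-resp-↭ (↭-sym c↭))) ⟩
  map (app π′) (range n)  ≡⟨ IsCycleOf⇒tabulate cyc′ ⟨
  π′                      ∎
  where
  open ≡-Reasoning
  open IsCycleOf
  c↭ = c↭range cyc
  agree : map (app π) c ≡ map (app π′) c
  agree = trans (rotates cyc) (sym (rotates cyc′))

map-iterates : ∀ π k x → map (app π) (iterates π k x) ≡ iterates π k (app π x)
map-iterates π zero x = refl
map-iterates π (suc k) x = cong (app π x ∷_) (map-iterates π k (app π x))

iterates-∷ʳ : ∀ π k x → ∃[ z ] iterates π (suc k) x ≡ iterates π k x ++ [ z ]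
iterates-∷ʳ π zero x = x , refl
iterates-∷ʳ π (suc k) x = let z , eq = iterates-∷ʳ π k (app π x) in z , cong (x ∷_) eq

length-iterates : ∀ π k x → length (iterates π k x) ≡ k
length-iterates π zero x = refl
length-iterates π (suc k) x = cong suc (length-iterates π k (app π x))

iterates-⊆ : ∀ {S} π k → (∀ {p} → p ∈ S → app π p ∈ S) → x ∈ S → iterates π k x ⊆ S
iterates-⊆ π (suc k) closed x∈ (here refl) = x∈
iterates-⊆ π (suc k) closed x∈ (there y∈) = iterates-⊆ π k closed (closed x∈) y∈

iterates-rotation : ∀ π x xs → map (app π) (x ∷ xs) ≡ xs ++ [ y ] →
  iterates π (length (x ∷ xs)) x ≡ x ∷ xs
iterates-rotation π x [] eq = refl
iterates-rotation π x (x′ ∷ xs) eq rewrite ∷-injectiveˡ eq =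
  cong (x ∷_) (iterates-rotation π x′ xs (∷-injectiveʳ eq))

iterates-∷ : ∀ π k x → 1 ≤ k → iterates π k x ≡ x ∷ drop 1 (iterates π k x)
iterates-∷ π (suc k) x _ = refl

iterates-∷∷ : ∀ π k x → 2 ≤ k → iterates π k x ≡ x ∷ app π x ∷ drop 2 (iterates π k x)
iterates-∷∷ π (suc (suc k)) x _ = refl
iterates-∷∷ π (suc zero) x (s≤s ())

IsCycleOf⇒cycleForm : IsCycleOf n π (1 ∷ c) → cycleForm π ≡ 1 ∷ c
IsCycleOf⇒cycleForm {π = π} {c} cyc = trans
  (cong (λ k → iterates π k 1) (trans length-π (sym (IsCycleOf⇒length cyc))))
  (iterates-rotation π 1 c rotates)
  where open IsCycleOf cyc

IsCycleOf⇒isCyclic : IsCycleOf n π (1 ∷ c) → T (isCyclic π)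
IsCycleOf⇒isCyclic {n} cyc = subst (T ∘ distinctᵇ) (sym (IsCycleOf⇒cycleForm cyc))
  (from T-distinctᵇ (Unique-resp-↭ (↭-sym (IsCycleOf.c↭range cyc)) (Unique-range n)))

module _ (π↭ : π ↭ range (suc n)) (cyclic : T (isCyclic π)) where

  private
    len : length π ≡ suc n
    len = trans (↭-length π↭) (length-range (suc n))

    c′ : List ℕ
    c′ = iterates π n (app π 1)

    cycleForm≡ : cycleForm π ≡ 1 ∷ c′
    cycleForm≡ = cong (λ k → iterates π k 1) len

    closed : ∀ {q} → q ∈ range (suc n) → app π q ∈ range (suc n)
    closed q∈ = ∈-resp-↭ π↭ (app-∈ π (subst (λ m → _ ∈ range m) (sym len) q∈))

  cycleForm-↭ : cycleForm π ↭ range (suc n)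
  cycleForm-↭ = Unique-⊆⇒↭ (to T-distinctᵇ cyclic)
    (subst (_⊆ range (suc n)) (sym cycleForm≡) (iterates-⊆ π (suc n) closed (∈-range⁺ ≤-refl (s≤s z≤n))))
    (≤-reflexive (trans (length-range (suc n)) (sym length≡)))
    where
    length≡ : length (cycleForm π) ≡ suc n
    length≡ = trans (cong length cycleForm≡) (length-iterates π (suc n) 1)

  -- π sends the last entry of the orbit of 1 to some z; as π is injective and the orbit
  -- exhausts [n], z can only be 1.
  cycleForm-rotates : map (app π) (cycleForm π) ≡ rotate (cycleForm π)
  cycleForm-rotates with z , c′++[z] ← iterates-∷ʳ π n (app π 1) = begin
    map (app π) (cycleForm π)  ≡⟨ image ⟩
    c′ ++ [ z ]                ≡⟨ cong (λ z → c′ ++ [ z ]) z≡1 ⟩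
    c′ ++ [ 1 ]                ≡⟨ cong rotate cycleForm≡ ⟨
    rotate (cycleForm π)       ∎
    where
    open ≡-Reasoning
    image : map (app π) (cycleForm π) ≡ c′ ++ [ z ]
    image = trans (cong (map (app π)) cycleForm≡) (trans (map-iterates π (suc n) 1) c′++[z])
    image↭π : map (app π) (cycleForm π) ↭ π
    image↭π = subst (map (app π) (cycleForm π) ↭_)
      (trans (cong (map (app π) ∘ range) (sym len)) (map-app-range π)) (↭-map⁺ (app π) cycleForm-↭)
    z∈ : z ∈ 1 ∷ c′
    z∈ = subst (z ∈_) cycleForm≡ (∈-resp-↭ (↭-sym cycleForm-↭) (∈-resp-↭ π↭ (∈-resp-↭ image↭π
           (subst (z ∈_) (sym image) (∈-++⁺ʳ c′ (here refl))))))
    z≡1 : z ≡ 1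
    z≡1 with z∈
    ... | here z≡1 = z≡1
    ... | there z∈c′ = ⊥-elim (Unique-∷ʳ⇒∉ (subst Unique image
            (Unique-resp-↭ (↭-sym image↭π) (Unique-resp-↭ (↭-sym π↭) (Unique-range (suc n))))) z∈c′)

isCyclic⇒IsCycleOf : π ↭ range n → T (isCyclic π) → IsCycleOf n π (cycleForm π)
isCyclic⇒IsCycleOf {n = zero} π↭ _ rewrite ↭-empty-inv π↭ =
  record { length-π = refl ; c↭range = ↭-refl ; rotates = refl }
isCyclic⇒IsCycleOf {n = suc n} π↭ cyclic = record
  { length-π = trans (↭-length π↭) (length-range (suc n))
  ; c↭range = cycleForm-↭ π↭ cyclic
  ; rotates = cycleForm-rotates π↭ cyclic
  }

lookupᵇ : List (ℕ × ℕ) → ℕ → ℕ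
lookupᵇ [] _ = 0
lookupᵇ ((k , v) ∷ kvs) x = if x ≡ᵇ k then v else lookupᵇ kvs x

map-lookupᵇ-zip : ∀ ks vs → Unique ks → length ks ≡ length vs →
  map (lookupᵇ (zip ks vs)) ks ≡ vs
map-lookupᵇ-zip [] [] _ _ = refl
map-lookupᵇ-zip (k ∷ ks) (v ∷ vs) (k∉ ∷ u) len rewrite ≡ᵇ-refl k =
  cong (v ∷_) (trans (map-cong-local (All.map skip k∉)) (map-lookupᵇ-zip ks vs u (suc-injective len)))
  where
  skip : k ≢ x → lookupᵇ ((k , v) ∷ zip ks vs) x ≡ lookupᵇ (zip ks vs) x
  skip k≢x rewrite ≡ᵇ-≢ (k≢x ∘ sym) = refl

fromCycle : ℕ → List ℕ → List ℕ
fromCycle n c = map (lookupᵇ (zip c (rotate c))) (range n)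

fromCycle-IsCycleOf : c ↭ range n → IsCycleOf n (fromCycle n c) c
fromCycle-IsCycleOf {c} {n} c↭ = record
  { length-π = trans (length-map _ (range n)) (length-range n)
  ; c↭range = c↭
  ; rotates = trans (map-cong-local (All.tabulate (app-map-range _ n ∘ ∈-resp-↭ c↭)))
                    (map-lookupᵇ-zip c (rotate c) (Unique-resp-↭ (↭-sym c↭) (Unique-range n))
                                     (sym (↭-length (rotate-↭ c))))
  }

fromCycle-unique : IsCycleOf n π c → fromCycle n c ≡ π
fromCycle-unique cyc = IsCycleOf-injective (fromCycle-IsCycleOf (IsCycleOf.c↭range cyc)) cyc

-- Joining and splitting cycles

range-split : ∀ j1 m → range (j1 + suc m) ≡ range (suc j1) ++ map (suc j1 +_) (range m)
range-split j1 m = trans (cong range (+-suc j1 m)) (range-+ (suc j1) m)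

shift-↭ : ∀ j1 {L′} → L′ ↭ map suc (range m) → map (j1 +_) L′ ↭ map (suc j1 +_) (range m)
shift-↭ {m} j1 {L′} p = begin
  map (j1 +_) L′                     ↭⟨ ↭-map⁺ (j1 +_) p ⟩
  map (j1 +_) (map suc (range m))    ≡⟨ map-∘ (range m) ⟨
  map ((j1 +_) ∘ suc) (range m)      ≡⟨ map-cong (+-suc j1) (range m) ⟩
  map (suc j1 +_) (range m)          ∎
  where open PermutationReasoning

unshift-↭ : ∀ j1 {L} → L ↭ map (suc j1 +_) (range m) → map (_∸ j1) L ↭ map suc (range m)
unshift-↭ {m} j1 {L} p = begin
  map (_∸ j1) L                              ↭⟨ ↭-map⁺ (_∸ j1) p ⟩
  map (_∸ j1) (map (suc j1 +_) (range m))    ≡⟨ map-∘ (range m) ⟨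
  map ((_∸ j1) ∘ (suc j1 +_)) (range m)      ≡⟨ map-cong cancel (range m) ⟩
  map suc (range m)                          ∎
  where
  open PermutationReasoning
  cancel : ∀ i → suc j1 + i ∸ j1 ≡ suc i
  cancel i = trans (cong (_∸ j1) (sym (+-suc j1 i))) (m+n∸m≡n j1 (suc i))

cycle-tail-bounds : 1 ∷ c ↭ range n → All (λ z → 1 < z × z ≤ n) c
cycle-tail-bounds {c} {n} p with 1∉c ∷ _ ← Unique-resp-↭ (↭-sym p) (Unique-range n) =
  All.tabulate bounds
  where
  bounds : z ∈ c → 1 < z × z ≤ n
  bounds z∈ with 1≤z , z≤max ← ∈-range⁻ (∈-resp-↭ p (there z∈)) =
    ≤∧≢⇒< 1≤z (All.lookup 1∉c z∈) , z≤max

-- Positions j1 + 1, …, j1 + m of the joined permutation: α shifted up by j1, except that the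
-- position that α sends to 1 is sent to x = β(j1 + 1). The value at 0 matches app's junk value.
lift : ℕ → ℕ → ℕ → ℕ
lift j1 x zero = zero
lift j1 x (suc zero) = x
lift j1 x (suc (suc v)) = j1 + suc (suc v)

lift-mono : 1 ≤ x → x ≤ suc j1 → lift j1 x Preserves _<_ ⟶ _<_
lift-mono 1≤x x≤j {zero} {suc zero} _ = 1≤x
lift-mono {j1 = j1} 1≤x x≤j {zero} {suc (suc v)} _ = ≤-trans (s≤s z≤n) (m≤n+m (suc (suc v)) j1)
lift-mono {j1 = j1} 1≤x x≤j {suc zero} {suc (suc v)} _ =
  ≤-<-trans x≤j (subst (_< j1 + suc (suc v)) (+-comm j1 1) (+-monoʳ-< j1 (s<s z<s)))
lift-mono {j1 = j1} 1≤x x≤j {suc (suc u)} {suc (suc v)} u<v = +-monoʳ-< j1 u<v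
lift-mono 1≤x x≤j {suc zero} {suc zero} (s<s ())
lift-mono 1≤x x≤j {suc (suc u)} {suc zero} (s<s ())

join : ℕ → List ℕ → List ℕ → List ℕ
join j1 β α = take j1 β ++ map (lift j1 (app β (suc j1))) α

-- The inverse of join: the cycle (1, j, r) of π, with j = j1 + 1, is cut into (1, j, S) and
-- (1, L′), where S lists the entries of r below j and L′ those above j, shifted down by j1.
split : ℕ → ℕ → List ℕ → List ℕ × List ℕ
split j1 m π =
  let r = drop 2 (cycleForm π) in
  fromCycle (suc j1) (1 ∷ suc j1 ∷ dropWhile (suc j1 <?_) r) ,
  fromCycle m (1 ∷ map (_∸ j1) (takeWhile (suc j1 <?_) r))

module Join {j1 m β α S L′}
  (βc : IsCycleOf (suc j1) β (1 ∷ suc j1 ∷ S)) (αc : IsCycleOf (suc m) α (1 ∷ L′)) where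

  private
    module β = IsCycleOf βc
    module α = IsCycleOf αc

  L : List ℕ
  L = map (j1 +_) L′

  β-last : ℕ
  β-last = app β (suc j1)

  L′-bounds : All (λ q → 1 < q × q ≤ suc m) L′
  L′-bounds = cycle-tail-bounds α.c↭range

  L-above : All (suc j1 <_) L
  L-above = All.map⁺ (All.map (λ {q} (1<q , _) → subst (_≤ j1 + q) (+-comm j1 2) (+-monoʳ-≤ j1 1<q))
                               L′-bounds)

  S-bounds : All (λ z → 1 < z × z < suc j1) S
  S-bounds with _ ∷ S-bounds′ ← cycle-tail-bounds β.c↭range
              | _ ∷ j∉S ∷ _ ← Unique-resp-↭ (↭-sym β.c↭range) (Unique-range (suc j1)) =
    All.zipWith (λ ((1<z , z≤j) , j≢z) → 1<z , ≤∧≢⇒< z≤j (j≢z ∘ sym)) (S-bounds′ , j∉S)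

  S-below : All (_< suc j1) S
  S-below = All.map proj₂ S-bounds

  cycle↭ : 1 ∷ suc j1 ∷ L ++ S ↭ range (j1 + suc m)
  cycle↭ = begin
    1 ∷ suc j1 ∷ L ++ S                                ↭⟨ ↭-prep 1 (↭-prep (suc j1) (++-comm L S)) ⟩
    (1 ∷ suc j1 ∷ S) ++ L                              ↭⟨ ↭-++⁺ β.c↭range (shift-↭ j1 L′↭) ⟩
    range (suc j1) ++ map (suc j1 +_) (range m)        ≡⟨ range-split j1 m ⟨
    range (j1 + suc m)                                 ∎
    where
    open PermutationReasoning
    L′↭ : L′ ↭ map suc (range m)
    L′↭ = drop-∷ (subst (1 ∷ L′ ↭_) (range-suc m) α.c↭range)

  private
    P : List ℕ
    P = take j1 β

    π₀ : List ℕ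
    π₀ = join j1 β α

    length-P : length P ≡ j1
    length-P = trans (length-take j1 β) (trans (cong (j1 ⊓_) β.length-π) (m≤n⇒m⊓n≡m (n≤1+n j1)))

    1≤j1 : 1 ≤ j1
    1≤j1 = s≤s⁻¹ (subst (2 ≤_) (IsCycleOf⇒length βc) (s≤s (s≤s z≤n)))

  β≡P++last : β ≡ P ++ [ β-last ]
  β≡P++last = take-last j1 β β.length-π

  app-join-β : ∀ {p} → 1 ≤ p → p ≤ j1 → app π₀ p ≡ app β p
  app-join-β 1≤p p≤j1 = trans (app-++ˡ P 1≤p (subst (_ ≤_) (sym length-P) p≤j1)) (app-take j1 β 1≤p p≤j1)

  app-join-α : ∀ {q} → 1 ≤ q → app π₀ (j1 + q) ≡ lift j1 β-last (app α q)
  app-join-α {q} 1≤q = begin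
    app π₀ (j1 + q)                  ≡⟨ cong (λ i → app π₀ (i + q)) length-P ⟨
    app π₀ (length P + q)            ≡⟨ app-++ʳ P 1≤q ⟩
    app (map (lift j1 β-last) α) q   ≡⟨ app-map refl α q ⟩
    lift j1 β-last (app α q)         ∎
    where open ≡-Reasoning

  join-rotates-L : app π₀ (suc j1) ∷ map (app π₀) L ≡ L ++ [ β-last ]
  join-rotates-L = begin
    app π₀ (suc j1) ∷ map (app π₀) L               ≡⟨ cong₂ _∷_ (cong (app π₀) (+-comm j1 1)) (map-∘ L′) ⟨
    map (app π₀ ∘ (j1 +_)) (1 ∷ L′)                 ≡⟨ map-cong-local (All.map app-join-α 1≤1∷L′) ⟩
    map (lift j1 β-last ∘ app α) (1 ∷ L′)           ≡⟨ map-∘ (1 ∷ L′) ⟩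
    map (lift j1 β-last) (map (app α) (1 ∷ L′))     ≡⟨ cong (map (lift j1 β-last)) α.rotates ⟩
    map (lift j1 β-last) (L′ ++ [ 1 ])              ≡⟨ map-++ (lift j1 β-last) L′ [ 1 ] ⟩
    map (lift j1 β-last) L′ ++ [ β-last ]           ≡⟨ cong (_++ [ β-last ]) (map-cong-local lift-L′) ⟩
    L ++ [ β-last ]                                 ∎
    where
    open ≡-Reasoning
    1≤1∷L′ : All (1 ≤_) (1 ∷ L′)
    1≤1∷L′ = s≤s z≤n ∷ All.map (<⇒≤ ∘ proj₁) L′-bounds
    lift-L′ : All (λ q → lift j1 β-last q ≡ j1 + q) L′
    lift-L′ = All.map (λ { {suc (suc q)} _ → refl ; {suc zero} (s≤s () , _) }) L′-bounds

  join-rotates : map (app π₀) (1 ∷ suc j1 ∷ L ++ S) ≡ rotate (1 ∷ suc j1 ∷ L ++ S)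
  join-rotates = begin
    app π₀ 1 ∷ app π₀ (suc j1) ∷ map (app π₀) (L ++ S)
      ≡⟨ cong₂ _∷_ (trans (app-join-β ≤-refl 1≤j1) (∷-injectiveˡ β.rotates))
                   (cong (_ ∷_) (map-++ (app π₀) L S)) ⟩
    suc j1 ∷ (app π₀ (suc j1) ∷ map (app π₀) L) ++ map (app π₀) S
      ≡⟨ cong (λ l → suc j1 ∷ l ++ map (app π₀) S) join-rotates-L ⟩
    suc j1 ∷ (L ++ [ β-last ]) ++ map (app π₀) S
      ≡⟨ cong (suc j1 ∷_) (++-assoc L [ β-last ] _) ⟩
    suc j1 ∷ L ++ β-last ∷ map (app π₀) S
      ≡⟨ cong (λ l → suc j1 ∷ L ++ β-last ∷ l) (map-cong-local (All.map app-join-S S-bounds)) ⟩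
    suc j1 ∷ L ++ β-last ∷ map (app β) S
      ≡⟨ cong (λ l → suc j1 ∷ L ++ l) (∷-injectiveʳ β.rotates) ⟩
    suc j1 ∷ L ++ S ++ [ 1 ]
      ≡⟨ cong (suc j1 ∷_) (++-assoc L S [ 1 ]) ⟨
    rotate (1 ∷ suc j1 ∷ L ++ S) ∎
    where
    open ≡-Reasoning
    app-join-S : ∀ {z} → 1 < z × z < suc j1 → app π₀ z ≡ app β z
    app-join-S (1<z , z<j) = app-join-β (<⇒≤ 1<z) (s≤s⁻¹ z<j)

  join-IsCycleOf : IsCycleOf (j1 + suc m) π₀ (1 ∷ suc j1 ∷ L ++ S)
  join-IsCycleOf = record
    { length-π = trans (length-++ P) (cong₂ _+_ length-P (trans (length-map _ α) α.length-π))
    ; c↭range = cycle↭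
    ; rotates = join-rotates
    }

  private
    β-range : ∀ {z} → z ∈ β → 1 ≤ z × z ≤ suc j1
    β-range = ∈-range⁻ ∘ ∈-resp-↭ (IsCycleOf⇒↭ βc)

    α-range : ∀ {z} → z ∈ α → 1 ≤ z × z ≤ suc m
    α-range = ∈-range⁻ ∘ ∈-resp-↭ (IsCycleOf⇒↭ αc)

    β-last∈β : β-last ∈ β
    β-last∈β = subst (β-last ∈_) (sym β≡P++last) (∈-++⁺ʳ P (here refl))

    lift-β-last-mono : lift j1 β-last Preserves _<_ ⟶ _<_
    lift-β-last-mono = lift-mono (proj₁ (β-range β-last∈β)) (proj₂ (β-range β-last∈β))

    P-below : All (_≤ suc j1) P
    P-below = All.tabulate (proj₂ ∘ β-range ∘ subst (_ ∈_) (sym β≡P++last) ∘ ∈-++⁺ˡ)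

    lifted-shape : All (λ z → z ≡ β-last ⊎ suc j1 < z) (map (lift j1 β-last) α)
    lifted-shape = All.map⁺ (All.tabulate (shape ∘ proj₁ ∘ α-range))
      where
      shape : ∀ {v} → 1 ≤ v → lift j1 β-last v ≡ β-last ⊎ suc j1 < lift j1 β-last v
      shape {suc zero} _ = inj₁ refl
      shape {suc (suc v)} _ = inj₂ (subst (_≤ j1 + suc (suc v)) (+-comm j1 2) (+-monoʳ-≤ j1 (s≤s (s≤s z≤n))))

    β-last∈lifted : β-last ∈ map (lift j1 β-last) α
    β-last∈lifted = ∈-map⁺ (lift j1 β-last) (∈-resp-↭ (↭-sym (IsCycleOf⇒↭ αc)) (∈-range⁺ ≤-refl (s≤s z≤n)))

  join-HasDecreasing⁻ : ∀ {k} → HasDecreasing k π₀ → HasDecreasing k β ⊎ HasDecreasing k α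
  join-HasDecreasing⁻ d with HasDecreasing-++⁻ P P-below lifted-shape d
  ... | inj₁ dβ = inj₁ (subst (HasDecreasing _) (sym β≡P++last) dβ)
  ... | inj₂ dα = inj₂ (HasDecreasing-map⁻ lift-β-last-mono dα)

  join-HasDecreasing⁺ : ∀ {k} → HasDecreasing k β ⊎ HasDecreasing k α → HasDecreasing k π₀
  join-HasDecreasing⁺ (inj₁ dβ) =
    HasDecreasing-⊑ (++⁺ ⊆-refl (from∈ β-last∈lifted)) (subst (HasDecreasing _) β≡P++last dβ)
  join-HasDecreasing⁺ (inj₂ dα) = HasDecreasing-⊑ (++⁺ˡ P ⊆-refl) (HasDecreasing-map⁺ lift-β-last-mono dα)

  private
    1≤L′ : All (1 ≤_) L′
    1≤L′ = All.map (<⇒≤ ∘ proj₁) L′-bounds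

    1≤tail : All (1 ≤_) (suc j1 ∷ L ++ S)
    1≤tail = s≤s z≤n ∷ All.++⁺ (All.map (λ j<z → ≤-trans (s≤s z≤n) (<⇒≤ j<z)) L-above)
                               (All.map (<⇒≤ ∘ proj₁) S-bounds)

  join-Has213⁻ : Has213 (1 ∷ suc j1 ∷ L ++ S) → Has213 (1 ∷ suc j1 ∷ S) ⊎ Has213 (1 ∷ L′)
  join-Has213⁻ h with Has213-∷-separated L-above S-below (Has213-∷-min 1≤tail h)
  ... | inj₁ hS = inj₁ (Has213-⊑ (1 ∷ʳ ⊆-refl) hS)
  ... | inj₂ hL = inj₂ (Has213-⊑ (1 ∷ʳ ⊆-refl) (Has213-map⁻ (+-monoʳ-< j1) hL))

  join-Has213⁺ : Has213 (1 ∷ suc j1 ∷ S) ⊎ Has213 (1 ∷ L′) → Has213 (1 ∷ suc j1 ∷ L ++ S)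
  join-Has213⁺ (inj₁ hS) = Has213-⊑ (refl ∷ refl ∷ ++⁺ˡ L ⊆-refl) hS
  join-Has213⁺ (inj₂ hL′) =
    Has213-⊑ (1 ∷ʳ suc j1 ∷ʳ ++⁺ʳ S ⊆-refl) (Has213-map⁺ (+-monoʳ-< j1) (Has213-∷-min 1≤L′ hL′))

  T-goodA-join : ∀ k → T (goodA k π₀) ⇔ (T (goodA k β) × T (goodA k α))
  T-goodA-join k = mk⇔ split-good join-good
    where
    cf-π₀ = IsCycleOf⇒cycleForm join-IsCycleOf
    cf-β = IsCycleOf⇒cycleForm βc
    cf-α = IsCycleOf⇒cycleForm αc
    split-good : T (goodA k π₀) → T (goodA k β) × T (goodA k α)
    split-good g with _ , noδ , no213 ← to (T-goodA k π₀) g =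
      from (T-goodA k β) (IsCycleOf⇒isCyclic βc , noδ ∘ join-HasDecreasing⁺ ∘ inj₁ ,
                          no213 ∘ subst Has213 (sym cf-π₀) ∘ join-Has213⁺ ∘ inj₁ ∘ subst Has213 cf-β) ,
      from (T-goodA k α) (IsCycleOf⇒isCyclic αc , noδ ∘ join-HasDecreasing⁺ ∘ inj₂ ,
                          no213 ∘ subst Has213 (sym cf-π₀) ∘ join-Has213⁺ ∘ inj₂ ∘ subst Has213 cf-α)
    join-good : T (goodA k β) × T (goodA k α) → T (goodA k π₀)
    join-good (gβ , gα) with _ , noδβ , no213β ← to (T-goodA k β) gβ
                           | _ , noδα , no213α ← to (T-goodA k α) gα =
      from (T-goodA k π₀) (IsCycleOf⇒isCyclic join-IsCycleOf , [ noδβ , noδα ]′ ∘ join-HasDecreasing⁻ ,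
        [ no213β ∘ subst Has213 (sym cf-β) , no213α ∘ subst Has213 (sym cf-α) ]′
          ∘ join-Has213⁻ ∘ subst Has213 cf-π₀)

  split-join : split j1 (suc m) π₀ ≡ (β , α)
  split-join = begin
    split j1 (suc m) π₀
      ≡⟨ cong (λ c → split′ (takeWhile (suc j1 <?_) (drop 2 c)) (dropWhile (suc j1 <?_) (drop 2 c)))
              (IsCycleOf⇒cycleForm join-IsCycleOf) ⟩
    split′ (takeWhile (suc j1 <?_) (L ++ S)) (dropWhile (suc j1 <?_) (L ++ S))
      ≡⟨ cong₂ split′ (takeWhile-separated (suc j1 <?_) L-above S-not-above)
                      (dropWhile-separated (suc j1 <?_) L-above S-not-above) ⟩
    split′ L S
      ≡⟨ cong₂ _,_ (fromCycle-unique βc)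
                   (trans (cong (λ l → fromCycle (suc m) (1 ∷ l)) unshift-L) (fromCycle-unique αc)) ⟩
    (β , α) ∎
    where
    open ≡-Reasoning
    split′ : List ℕ → List ℕ → List ℕ × List ℕ
    split′ L S = fromCycle (suc j1) (1 ∷ suc j1 ∷ S) , fromCycle (suc m) (1 ∷ map (_∸ j1) L)
    S-not-above : All (λ z → ¬ suc j1 < z) S
    S-not-above = All.map (λ z<j j<z → <-asym z<j j<z) S-below
    unshift-L : map (_∸ j1) L ≡ L′
    unshift-L = trans (sym (map-∘ L′)) (trans (map-cong (m+n∸m≡n j1) L′) (map-id L′))

module Split {j1 m π r}
  (πc : IsCycleOf (j1 + suc m) π (1 ∷ suc j1 ∷ r)) (no213 : ¬ Has213 (1 ∷ suc j1 ∷ r)) where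

  private
    module π = IsCycleOf πc

  L S L′ : List ℕ
  L = takeWhile (suc j1 <?_) r
  S = dropWhile (suc j1 <?_) r
  L′ = map (_∸ j1) L

  L++S≡r : L ++ S ≡ r
  L++S≡r = takeWhile++dropWhile (suc j1 <?_) r

  L-above : All (suc j1 <_) L
  L-above = All.all-takeWhile (suc j1 <?_) r

  S-below : All (_< suc j1) S
  S-below with _ ∷ j∉r ∷ _ ← Unique-resp-↭ (↭-sym π.c↭range) (Unique-range (j1 + suc m)) =
    Has213-free⇒dropWhile-below (suc j1) r (All¬⇒¬Any j∉r) (no213 ∘ Has213-⊑ (1 ∷ʳ ⊆-refl))

  shift-L′ : map (j1 +_) L′ ≡ L
  shift-L′ = trans (sym (map-∘ L))
    (trans (map-cong-local (All.map (λ j<z → m+[n∸m]≡n (<⇒≤ (<-trans (n<1+n j1) j<z))) L-above)) (map-id L))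

  private
    parts↭ : (1 ∷ suc j1 ∷ S) ↭ range (suc j1) × L ↭ map (suc j1 +_) (range m)
    parts↭ = ↭-separated (_≤? suc j1)
      (s≤s z≤n ∷ ≤-refl ∷ All.map <⇒≤ S-below)
      (All.map <⇒≱ L-above)
      (All.tabulate (proj₂ ∘ ∈-range⁻))
      (All.tabulate λ z∈ → let i , i∈ , z≡ = ∈-map⁻ (suc j1 +_) z∈ in
         <⇒≱ (subst (suc j1 <_) (sym z≡) (m<m+n (suc j1) (proj₁ (∈-range⁻ i∈)))))
      (begin
        (1 ∷ suc j1 ∷ S) ++ L                          ↭⟨ ↭-prep 1 (↭-prep (suc j1) (++-comm S L)) ⟩
        1 ∷ suc j1 ∷ L ++ S                            ≡⟨ cong (λ l → 1 ∷ suc j1 ∷ l) L++S≡r ⟩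
        1 ∷ suc j1 ∷ r                                 ↭⟨ π.c↭range ⟩
        range (j1 + suc m)                             ≡⟨ range-split j1 m ⟩
        range (suc j1) ++ map (suc j1 +_) (range m)    ∎)
      where open PermutationReasoning

  β-IsCycleOf : IsCycleOf (suc j1) (fromCycle (suc j1) (1 ∷ suc j1 ∷ S)) (1 ∷ suc j1 ∷ S)
  β-IsCycleOf = fromCycle-IsCycleOf (proj₁ parts↭)

  α-IsCycleOf : IsCycleOf (suc m) (fromCycle (suc m) (1 ∷ L′)) (1 ∷ L′)
  α-IsCycleOf = fromCycle-IsCycleOf
    (subst (1 ∷ L′ ↭_) (sym (range-suc m)) (↭-prep 1 (unshift-↭ j1 (proj₂ parts↭))))

  join-split : join j1 (fromCycle (suc j1) (1 ∷ suc j1 ∷ S)) (fromCycle (suc m) (1 ∷ L′)) ≡ π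
  join-split = IsCycleOf-injective
    (subst (IsCycleOf _ _) same-cycle (Join.join-IsCycleOf β-IsCycleOf α-IsCycleOf)) πc
    where
    same-cycle : 1 ∷ suc j1 ∷ map (j1 +_) L′ ++ S ≡ 1 ∷ suc j1 ∷ r
    same-cycle = cong (λ l → 1 ∷ suc j1 ∷ l) (trans (cong (_++ S) shift-L′) L++S≡r)

-- The bijection

firstIs⇔app : ∀ π {j} → 1 ≤ length π → T (firstIs j π) ⇔ app π 1 ≡ j
firstIs⇔app (x ∷ π) {j} _ = mk⇔ (≡ᵇ⇒≡ x j) (≡⇒≡ᵇ x j)

firstIs≡ : ∀ {j} π → 1 ≤ length π → firstIs j π ≡ (app π 1 ≡ᵇ j)
firstIs≡ (x ∷ π) _ = refl

IsCycleOf⇒firstIs : IsCycleOf n π (1 ∷ j ∷ c) → T (firstIs j π)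
IsCycleOf⇒firstIs {π = π} cyc =
  from (firstIs⇔app π (subst (1 ≤_) (trans (IsCycleOf⇒length cyc) (sym length-π)) (s≤s z≤n)))
       (∷-injectiveˡ rotates)
  where open IsCycleOf cyc

good⇒IsCycleOf : π ∈ perms n → T (goodA k π) → IsCycleOf n π (cycleForm π)
good⇒IsCycleOf {π} {n} {k} π∈ good =
  isCyclic⇒IsCycleOf (∈-perms⁻ {n = n} π∈) (proj₁ (to (T-goodA k π) good))

good⇒IsCycleOf-∷ : π ∈ perms (suc n) → T (goodA k π) → IsCycleOf (suc n) π (1 ∷ drop 1 (cycleForm π))
good⇒IsCycleOf-∷ {π} {n} {k} π∈ good = subst (IsCycleOf (suc n) π)
  (iterates-∷ π (length π) 1 (subst (1 ≤_) (sym (length-perms {n = suc n} π∈)) (s≤s z≤n)))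
  (good⇒IsCycleOf {k = k} π∈ good)

good⇒IsCycleOf-∷∷ : 2 ≤ n → π ∈ perms n → T (goodA k π) → T (firstIs j π) →
  IsCycleOf n π (1 ∷ j ∷ drop 2 (cycleForm π))
good⇒IsCycleOf-∷∷ {n} {π} {k} {j} 2≤n π∈ good first =
  subst (IsCycleOf n π) cycleForm≡ (good⇒IsCycleOf {k = k} π∈ good)
  where
  2≤len : 2 ≤ length π
  2≤len = subst (2 ≤_) (sym (length-perms π∈)) 2≤n
  cycleForm≡ : cycleForm π ≡ 1 ∷ j ∷ drop 2 (cycleForm π)
  cycleForm≡ = trans (iterates-∷∷ π (length π) 1 2≤len)
    (cong (λ x → 1 ∷ x ∷ _) (to (firstIs⇔app π (≤-trans (s≤s z≤n) 2≤len)) first))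

module _ (k j1 m : ℕ) (1≤j1 : 1 ≤ j1) where

  private
    good-first : List ℕ → Bool
    good-first π = goodA k π ∧ firstIs (suc j1) π

    good-pair : List ℕ × List ℕ → Bool
    good-pair βα = good-first (proj₁ βα) ∧ goodA k (proj₂ βα)

    2≤n : 2 ≤ j1 + suc m
    2≤n = ≤-trans (s≤s 1≤j1) (subst (_≤ j1 + suc m) (+-comm j1 1) (+-monoʳ-≤ j1 (s≤s z≤n)))

  split-good : π ∈ perms (j1 + suc m) → T (good-first π) →
    split j1 (suc m) π ∈ cartesianProduct (perms (suc j1)) (perms (suc m)) ×
    T (good-pair (split j1 (suc m) π)) × uncurry (join j1) (split j1 (suc m) π) ≡ π
  split-good {π} π∈ h with good , first ← to T-∧ h =
    ∈-cartesianProduct⁺ (∈-perms⁺ (IsCycleOf⇒↭ β-IsCycleOf)) (∈-perms⁺ (IsCycleOf⇒↭ α-IsCycleOf)) ,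
    from T-∧ (from T-∧ (proj₁ good-βα , IsCycleOf⇒firstIs β-IsCycleOf) , proj₂ good-βα) ,
    join-split
    where
    πc = good⇒IsCycleOf-∷∷ {k = k} 2≤n π∈ good first
    open Split πc (proj₂ (proj₂ (to (T-goodA k π) good)) ∘ subst Has213 (sym (IsCycleOf⇒cycleForm πc)))
    good-βα = to (Join.T-goodA-join β-IsCycleOf α-IsCycleOf k) (subst (T ∘ goodA k) (sym join-split) good)

  join-good : ∀ {βα} → βα ∈ cartesianProduct (perms (suc j1)) (perms (suc m)) → T (good-pair βα) →
    uncurry (join j1) βα ∈ perms (j1 + suc m) × T (good-first (uncurry (join j1) βα)) ×
    split j1 (suc m) (uncurry (join j1) βα) ≡ βα
  join-good {β , α} βα∈ h
    with β∈ , α∈ ← ∈-cartesianProduct⁻ (perms (suc j1)) (perms (suc m)) βα∈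
       | good-first-β , good-α ← to T-∧ h
    with good-β , first-β ← to T-∧ good-first-β =
    ∈-perms⁺ (IsCycleOf⇒↭ join-IsCycleOf) ,
    from T-∧ (from (T-goodA-join k) (good-β , good-α) , IsCycleOf⇒firstIs join-IsCycleOf) ,
    split-join
    where
    open Join (good⇒IsCycleOf-∷∷ {k = k} (s≤s 1≤j1) β∈ good-β first-β)
              (good⇒IsCycleOf-∷ {n = m} {k} α∈ good-α)

  count-good-first : count good-first (perms (j1 + suc m)) ≡ b (suc j1) k * a (suc m) k
  count-good-first = trans
    (count-bijection good-first good-pair (split j1 (suc m)) (uncurry (join j1))
      (Unique-perms (j1 + suc m)) (Unique.cartesianProduct⁺ (Unique-perms (suc j1)) (Unique-perms (suc m)))
      split-good join-good)
    (count-cartesianProduct good-first (goodA k) (perms (suc j1)) (perms (suc m)))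

count-first-entry : ∀ k {n j} → 2 ≤ j → j ≤ n →
  count (λ π → goodA k π ∧ firstIs j π) (perms n) ≡ b j k * a (n + 1 ∸ j) k
count-first-entry k {n} {suc j1} (s≤s 1≤j1) j≤n = begin
  count (λ π → goodA k π ∧ firstIs (suc j1) π) (perms n)
    ≡⟨ cong (count _ ∘ perms) n≡ ⟨
  count (λ π → goodA k π ∧ firstIs (suc j1) π) (perms (j1 + suc n∸j))
    ≡⟨ count-good-first k j1 n∸j 1≤j1 ⟩
  b (suc j1) k * a (suc n∸j) k
    ≡⟨ cong (λ i → b (suc j1) k * a i k) m≡ ⟨
  b (suc j1) k * a (n + 1 ∸ suc j1) k ∎
  where
  open ≡-Reasoning
  n∸j = n ∸ suc j1
  n≡ : j1 + suc n∸j ≡ n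
  n≡ = trans (+-suc j1 n∸j) (m+[n∸m]≡n j≤n)
  m≡ : n + 1 ∸ suc j1 ≡ suc n∸j
  m≡ = trans (cong (_∸ suc j1) (+-comm n 1)) (+-∸-assoc 1 j≤n)

first-entry-bounds : 2 ≤ n → π ∈ perms n → T (goodA k π) → 1 < app π 1 × app π 1 ≤ n
first-entry-bounds {n} {π} {k} 2≤n π∈ good = All.head (cycle-tail-bounds (IsCycleOf.c↭range
  (good⇒IsCycleOf-∷∷ {k = k} 2≤n π∈ good (from (firstIs⇔app π 1≤len) refl))))
  where
  1≤len : 1 ≤ length π
  1≤len = subst (1 ≤_) (sym (length-perms π∈)) (≤-trans (s≤s z≤n) 2≤n)

lemma2p2 : (n k : ℕ) → 2 ≤ n → 3 ≤ k →
    a n k ≡ sumFromTo 2 n (λ j → b j k * a (n + 1 ∸ j) k)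
lemma2p2 n@(suc (suc n′)) k 2≤n@(s≤s (s≤s _)) _ = begin
  a n k
    ≡⟨ count-partition (goodA k) firstIs (λ π → app π 1) (perms n) 2 (suc n′) first-entry ⟩
  sumFrom 2 (suc n′) (λ j → count (λ π → goodA k π ∧ firstIs j π) (perms n))
    ≡⟨ sumFrom-cong {i = 2} {r = suc n′} (λ 2≤j j<2+n′ → count-first-entry k 2≤j (s≤s⁻¹ j<2+n′)) ⟩
  sumFrom 2 (suc n′) F
    ≡⟨ sumFromTo≡sumFrom F (suc n′) 2 n (+-comm (suc n′) 2) ⟨
  sumFromTo 2 n F ∎
  where
  open ≡-Reasoning
  F = λ j → b j k * a (n + 1 ∸ j) k
  first-entry : π ∈ perms n → T (goodA k π) →
    2 ≤ app π 1 × app π 1 < 2 + suc n′ × (∀ j → firstIs j π ≡ (app π 1 ≡ᵇ j))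
  first-entry {π} π∈ good with 1<x , x≤n ← first-entry-bounds {k = k} 2≤n π∈ good =
    1<x , s≤s x≤n , λ j → firstIs≡ π (subst (1 ≤_) (sym (length-perms {n = n} π∈)) (s≤s z≤n))
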